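{- For every $m\ge1$ and every $m$-colored composition $\alpha$, \[\left(L^{(m)}_{(1)}+L^{(m)}_{(\omega 1)}+\cdots+L^{(m)}_{(\omega^{m-1}1)}\right)L^{(m)}_{\alpha}=\sum_{\beta:\ \alpha\prec\beta}L^{(m)}_{\beta},\] where the sum is over all $\beta$ covering $\alpha$ in $\mathrm{Comp}^{(m)}$.
   Context: Let $\omega$ be a primitive $m$-th root of unity and $C_m=\{1,\omega,\ldots,\omega^{m-1}\}$. An $m$-colored composition of $n$ is a tuple $\alpha=(\omega^{j_1}\alpha_1,\ldots,\omega^{j_k}\alpha_k)$ of positive integers $\alpha_s$ with colors $\omega^{j_s}$, $0\le j_s\le m-1$, summing to $n$. $\mathrm{Comp}^{(m)}$ is the poset on all such compositions (all $n\ge 0$, with $\emptyset$ for $n=0$) generated by the covers: $\beta$ covers $\alpha=(\varepsilon_1\alpha_1,\ldots,\varepsilon_k\alpha_k)$, written $\alpha\prec\beta$, iff for some $j$, $\beta$ is obtained by (1) replacing $\varepsilon_j\alpha_j$ by $\varepsilon_j(\alpha_j+1)$; or (2) replacing $\varepsilon_j\alpha_j$ by $\varepsilon_j(h+1),\varepsilon_j(\alpha_j-h)$ for some $0\le h\le\alpha_j-1$; or (3) replacing $\varepsilon_j\alpha_j$ by $\varepsilon_j h,\varepsilon'1,\varepsilon_j(\alpha_j-h)$ with $\varepsilon'\ne\varepsilon_j$, $0\le h\le\alpha_j-1$, deleting parts of size $0$ (covers of $\emptyset$ are the $(\varepsilon 1)$). Colored fundamental quasisymmetric functions (Poirier): work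 with formal power series in the variables $x_{c,i}$, $0\le c\le m-1$, $i\ge1$. For $\alpha=(\omega^{j_1}\alpha_1,\ldots,\omega^{j_k}\alpha_k)$ of $n$ and $1\le s\le n$, write $s=\alpha_1+\cdots+\alpha_r+h$ with $1\le h\le\alpha_{r+1}$ and set $j'_s=j_{r+1}$. Then \[L^{(m)}_\alpha=\sum x_{j'_1,i_1}x_{j'_2,i_2}\cdots x_{j'_n,i_n},\] summed over all $i_1\le i_2\le\cdots\le i_n$ of positive integers such that $i_s<i_{s+1}$ whenever both $j'_s\ge j'_{s+1}$ and $s=\alpha_1+\cdots+\alpha_r$ for some $r$. ($L^{(m)}_\emptyset=1$.) -}

module Defs where

open import Data.Nat as ℕ using (ℕ; zero; suc; _+_; _*_; _∸_; _≤ᵇ_; _<ᵇ_)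
open import Data.Fin as Fin using (Fin; toℕ)
open import Data.Bool using (Bool; true; false; _∧_; if_then_else_)
open import Data.List using (List; []; _∷_; _++_; map; concatMap; replicate; length; filter; filterᵇ; upTo; allFin; deduplicate; zip)
open import Data.Nat.ListAction using (sum)
open import Data.Vec as Vec using (Vec; []; _∷_)
open import Data.Product using (_×_; _,_; proj₁; proj₂)
open import Data.List.Relation.Unary.All using (All)
open import Relation.Nullary.Decidable using (⌊_⌋; ¬?)
open import Relation.Binary.PropositionalEquality using (_≡_)
open import Relation.Binary.Definitions using (DecidableEquality)
import Data.List.Properties as LP
import Data.Vec.Properties as VP
import Data.Product.Properties as PP

-- m-colored compositions
-- A part  ω^j a  is represented by the pair (j , a) with j : Fin m.

Part : ℕ → Set
Part m = Fin m × ℕ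

ColComp : ℕ → Set
ColComp m = List (Part m)

IsColComp : ∀ {m} → ColComp m → Set
IsColComp α = All (λ p → 1 ℕ.≤ proj₂ p) α

_≟C_ : ∀ {m} → DecidableEquality (ColComp m)
_≟C_ = LP.≡-dec (PP.≡-dec Fin._≟_ ℕ._≟_)

deleteZeros : ∀ {m} → ColComp m → ColComp m
deleteZeros = filter (λ p → ¬? (proj₂ p ℕ.≟ 0))

-- the replacements of a single part  ε a  given by rules (1), (2), (3)
localCovers : ∀ {m} → Part m → List (ColComp m)
localCovers {m} (ε , a) =
  ((ε , suc a) ∷ [])
  ∷ map (λ h → (ε , suc h) ∷ (ε , a ∸ h) ∷ []) (upTo a)
  ++ concatMap (λ h → concatMap (λ ε' →
        if ⌊ ε' Fin.≟ ε ⌋ then []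
        else (((ε , h) ∷ (ε' , 1) ∷ (ε , a ∸ h) ∷ []) ∷ []))
        (allFin m)) (upTo (suc a))

coversAt : ∀ {m} → ColComp m → List (ColComp m)
coversAt [] = []
coversAt (p ∷ ps) = map (_++ ps) (localCovers p) ++ map (p ∷_) (coversAt ps)

-- all (with possible repetitions) β with α ≺ β
coverList : ∀ {m} → ColComp m → List (ColComp m)
coverList {m} [] = map (λ ε → (ε , 1) ∷ []) (allFin m)
coverList (p ∷ ps) = map deleteZeros (coversAt (p ∷ ps))

coverSet : ∀ {m} → ColComp m → List (ColComp m)
coverSet α = deduplicate _≟C_ (coverList α)

-- Formal power series in the variables x_{c,i} (0 ≤ c ≤ m-1, i ≥ 1),
-- with ℕ coefficients, given by their coefficients.
-- A monomial only involving x_{c,i} with i ≤ N is  Mono m N : the entry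
-- in row k (k : Fin N, i = toℕ k + 1) and column c is the exponent of x_{c,i}.
-- A series assigns a coefficient to each such monomial (for every N).

Mono : ℕ → ℕ → Set
Mono m N = Vec (Vec ℕ m) N

Series : ℕ → Set
Series m = (N : ℕ) → Mono m N → ℕ

_≈_ : ∀ {m} → Series m → Series m → Set
f ≈ g = ∀ N M → f N M ≡ g N M

infix 4 _≈_

_⊕_ : ∀ {m} → Series m → Series m → Series m
(f ⊕ g) N M = f N M + g N M

zeroS : ∀ {m} → Series m
zeroS N M = 0

sumS : ∀ {m} → List (Series m) → Series m
sumS [] = zeroS
sumS (f ∷ fs) = f ⊕ sumS fs

belowVec : ∀ {k} → Vec ℕ k → List (Vec ℕ k)
belowVec [] = [] ∷ []
belowVec (x ∷ xs) = concatMap (λ y → map (y ∷_) (belowVec xs)) (upTo (suc x))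

belowMono : ∀ {m N} → Mono m N → List (Mono m N)
belowMono [] = [] ∷ []
belowMono (r ∷ rs) = concatMap (λ r₁ → map (r₁ ∷_) (belowMono rs)) (belowVec r)

_∸M_ : ∀ {m N} → Mono m N → Mono m N → Mono m N
M ∸M M₁ = Vec.zipWith (Vec.zipWith _∸_) M M₁

_⊗_ : ∀ {m} → Series m → Series m → Series m
(f ⊗ g) N M = sum (map (λ M₁ → f N M₁ * g N (M ∸M M₁)) (belowMono M))

colorSeq : ∀ {m} → ColComp m → List (Fin m)
colorSeq = concatMap (λ p → replicate (proj₂ p) (proj₁ p))

-- flag at position s: true iff s = α_1 + ⋯ + α_r for some r
partEndFlags : ℕ → List Bool
partEndFlags zero = []
partEndFlags (suc k) = replicate k false ++ true ∷ []

endFlags : ∀ {m} → ColComp m → List Bool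
endFlags = concatMap (λ p → partEndFlags (proj₂ p))

admissible : ∀ {m N} → List (Fin m × Bool × Fin N) → Bool
admissible ((c , f , i) ∷ (c' , f' , i') ∷ rest) =
  (toℕ i ≤ᵇ toℕ i')
  ∧ (if f ∧ (toℕ c' ≤ᵇ toℕ c) then toℕ i <ᵇ toℕ i' else true)
  ∧ admissible ((c' , f' , i') ∷ rest)
admissible _ = true

allSeqs : (N n : ℕ) → List (List (Fin N))
allSeqs N zero = [] ∷ []
allSeqs N (suc n) = concatMap (λ i → map (i ∷_) (allSeqs N n)) (allFin N)

zeroMono : ∀ {m N} → Mono m N
zeroMono {m} {N} = Vec.replicate N (Vec.replicate m 0)

monoOf : ∀ {m N} → List (Fin m × Fin N) → Mono m N
monoOf [] = zeroMono
monoOf ((c , i) ∷ rest) = Vec.updateAt (monoOf rest) i (λ r → Vec.updateAt r c suc)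

L : ∀ {m} → ColComp m → Series m
L α N M =
  length (filterᵇ
    (λ is → admissible (zip (colorSeq α) (zip (endFlags α) is))
            ∧ ⌊ VP.≡-dec (VP.≡-dec ℕ._≟_) (monoOf (zip (colorSeq α) is)) M ⌋)
    (allSeqs N (length (colorSeq α))))

sumL1 : (m : ℕ) → Series m
sumL1 m = sumS (map (λ ε → L ((ε , 1) ∷ [])) (allFin m))

-- The coefficient of a monomial in L_α counts the index sequences i₁ ≤ ⋯ ≤ iₙ that are admissible for
-- the word of α, the letters (j′ₛ , whether s ends a part). Order the variables x_{c,i} lexicographically
-- by (i , c): admissibility says exactly that consecutive variables weakly increase, strictly after the
-- end of a part. Multiplying by x_{ε,i} therefore inserts a new part (ε 1) into the word, at the unique
-- place where x_{ε,i} fits in this order; the letter before it then ends its part iff its colour is not ε.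
-- So (∑_ε L_(ε1)) L_α is the sum of L over the words obtained by one such insertion, and these are the
-- words of the β covering α, each arising from exactly one insertion.

module Submission where

open import Defs
open import Algebra using (CommutativeMonoid)
import Algebra.Properties.CommutativeSemigroup as CommutativeSemigroupProperties
open import Data.Bool using (Bool; true; false; _∧_; not; T; if_then_else_)
open import Data.Bool.Properties using (∧-assoc; ∧-identityʳ; ∧-commutativeMonoid; T-∧)
open import Data.Empty using (⊥-elim)
open import Data.Fin as Fin using (Fin; zero; suc; toℕ)
open import Data.Fin.Properties using (toℕ-injective)
open import Data.List using (List; []; _∷_; _++_; map; concatMap; length; upTo; allFin; zip; replicate; fromMaybe; filterᵇ; cartesianProduct)
open import Data.List.Membership.Propositional using (_∈_; find; lose)
open import Data.List.Membership.Propositional.Properties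
  using ( ∈-++⁻; ∈-++⁺ˡ; ∈-++⁺ʳ; ∈-map⁻; ∈-map⁺; ∈-concatMap⁻; ∈-concatMap⁺; ∈-upTo⁻; ∈-upTo⁺; ∈-allFin
        ; ∈-cartesianProduct⁻; ∈-cartesianProduct⁺; ∈-deduplicate⁻; ∈-deduplicate⁺ )
open import Data.List.Membership.Propositional.Properties.WithK using (unique∧set⇒bag)
open import Data.List.Properties
  using (map-++; map-∘; map-cong; map-upTo; length-replicate; length-++; filter-++; filter-all; ∷-injective; ∷-injectiveˡ; ∷-injectiveʳ)
open import Data.List.Relation.Binary.BagAndSetEquality using (∼bag⇒↭)
open import Data.List.Relation.Binary.Permutation.Propositional.Properties using () renaming (map⁺ to ↭-map⁺)
open import Data.List.Relation.Unary.All as All using (All; []; _∷_)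
open import Data.List.Relation.Unary.All.Properties using (all-filter)
open import Data.List.Relation.Unary.AllPairs using ([]; _∷_)
open import Data.List.Relation.Unary.Any using (here; there)
open import Data.List.Relation.Unary.Linked using (Linked; []; [-]; _∷_)
open import Data.List.Relation.Unary.Unique.DecPropositional.Properties using (deduplicate-!)
open import Data.List.Relation.Unary.Unique.Propositional using (Unique)
open import Data.List.Relation.Unary.Unique.Propositional.Properties using (cartesianProduct⁺; allFin⁺; upTo⁺)
open import Data.Maybe as Maybe using (Maybe; just; nothing)
open import Data.Nat using (ℕ; zero; suc; _+_; _*_; _∸_; _≤_; _<_; _≤ᵇ_; _<ᵇ_; _≟_; s≤s; z≤n)
open import Data.Nat.ListAction using (sum)
open import Data.Nat.ListAction.Properties using (sum-++; sum-↭)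
open import Data.Nat.Properties
  using ( +-identityʳ; *-identityˡ; *-zeroʳ; +-comm; *-comm; +-suc; *-distribˡ-+; *-distribʳ-+; suc-injective
        ; +-commutativeSemigroup; _≤?_; ≤-refl; ≤-trans; <-trans; ≤-<-trans; <⇒≤; <-irrefl; <-asym; <⇒≱; ≰⇒>; <-cmp
        ; ≤-pred; n≤1+n; m≤m+n; +-monoʳ-≤; +-cancelˡ-≤; ∸-monoˡ-≤; m≤n⇒m<n∨m≡n; m≤n⇒∃[o]m+o≡n; >⇒≢; n≢0⇒n>0
        ; m+n∸m≡n; m+[n∸m]≡n; ∸-+-assoc; +-∸-assoc; n∸n≡0; ≤ᵇ⇒≤; ≤⇒≤ᵇ; <ᵇ⇒<; <⇒<ᵇ )
open import Data.Nat.Tactic.RingSolver using (solve-∀)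
open import Data.Product using (Σ-syntax; _×_; _,_; proj₁; proj₂)
open import Data.Sum using (_⊎_; inj₁; inj₂; [_,_]′)
open import Data.Unit using (⊤; tt)
open import Data.Vec as Vec using (Vec; []; _∷_)
import Data.Vec.Properties as Vecₚ
open import Function using (_∘_; _⇔_; mk⇔; Equivalence)
import Function.Properties.Equivalence as ⇔
open import Relation.Binary.Definitions using (DecidableEquality; tri<; tri≈; tri>)
open import Relation.Binary.PropositionalEquality using (_≡_; _≢_; refl; sym; trans; cong; cong₂; subst; module ≡-Reasoning)
open import Relation.Nullary using (¬_; Dec)
open import Relation.Nullary.Decidable using (does; ⌊_⌋; yes; no; ¬?; _×-dec_; does-⇔; dec-true; dec-false; isYes≗does)

open CommutativeSemigroupProperties +-commutativeSemigroup using () renaming (interchange to +-interchange)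
open CommutativeSemigroupProperties (CommutativeMonoid.commutativeSemigroup ∧-commutativeMonoid) using () renaming (interchange to ∧-interchange)
open Equivalence using (to; from)

private
  variable
    A B : Set
    m N : ℕ

𝟙 : Bool → ℕ
𝟙 true = 1
𝟙 false = 0

𝟙-∧ : ∀ a b → 𝟙 (a ∧ b) ≡ 𝟙 a * 𝟙 b
𝟙-∧ true b = sym (+-identityʳ (𝟙 b))
𝟙-∧ false b = refl

∑ : List A → (A → ℕ) → ℕ
∑ xs f = sum (map f xs)

syntax ∑ xs (λ x → e) = ∑[ x ← xs ] e

∑-++ : ∀ (xs ys : List A) f → ∑ (xs ++ ys) f ≡ ∑ xs f + ∑ ys f
∑-++ xs ys f = trans (cong sum (map-++ f xs ys)) (sum-++ (map f xs) (map f ys))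

∑-map : ∀ (g : A → B) xs f → ∑ (map g xs) f ≡ ∑ xs (f ∘ g)
∑-map g xs f = cong sum (sym (map-∘ xs))

∑-concatMap : ∀ (g : A → List B) xs f → ∑ (concatMap g xs) f ≡ ∑[ x ← xs ] ∑ (g x) f
∑-concatMap g [] f = refl
∑-concatMap g (x ∷ xs) f = trans (∑-++ (g x) (concatMap g xs) f) (cong (∑ (g x) f +_) (∑-concatMap g xs f))

∑-cong : ∀ (xs : List A) {f g} → (∀ x → f x ≡ g x) → ∑ xs f ≡ ∑ xs g
∑-cong xs f≗g = cong sum (map-cong f≗g xs)

∑-+ : ∀ (xs : List A) f g → ∑[ x ← xs ] (f x + g x) ≡ ∑ xs f + ∑ xs g
∑-+ [] f g = refl
∑-+ (x ∷ xs) f g = trans (cong (f x + g x +_) (∑-+ xs f g)) (+-interchange (f x) (g x) (∑ xs f) (∑ xs g))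

∑-*ˡ : ∀ (xs : List A) k f → ∑[ x ← xs ] (k * f x) ≡ k * ∑ xs f
∑-*ˡ [] k f = sym (*-zeroʳ k)
∑-*ˡ (x ∷ xs) k f = trans (cong (k * f x +_) (∑-*ˡ xs k f)) (sym (*-distribˡ-+ k (f x) (∑ xs f)))

∑-*ˡ₂ : ∀ (xs : List A) k l f → ∑[ x ← xs ] (k * (l * f x)) ≡ k * (l * ∑ xs f)
∑-*ˡ₂ xs k l f = trans (∑-*ˡ xs k (λ x → l * f x)) (cong (k *_) (∑-*ˡ xs l f))

∑-*ʳ : ∀ (xs : List A) f k → ∑ xs f * k ≡ ∑[ x ← xs ] (f x * k)
∑-*ʳ xs f k = trans (*-comm (∑ xs f) k) (trans (sym (∑-*ˡ xs k f)) (∑-cong xs (λ x → *-comm k (f x))))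

∑-zero : ∀ (xs : List A) → ∑[ x ← xs ] 0 ≡ 0
∑-zero [] = refl
∑-zero (x ∷ xs) = ∑-zero xs

∑-comm : ∀ (xs : List A) (ys : List B) (f : A → B → ℕ) → ∑[ x ← xs ] ∑[ y ← ys ] f x y ≡ ∑[ y ← ys ] ∑[ x ← xs ] f x y
∑-comm [] ys f = sym (∑-zero ys)
∑-comm (x ∷ xs) ys f = trans (cong (∑ ys (f x) +_) (∑-comm xs ys f)) (sym (∑-+ ys (f x) (λ y → ∑[ x′ ← xs ] f x′ y)))

∑-cartesianProduct : ∀ (xs : List A) (ys : List B) f → ∑ (cartesianProduct xs ys) f ≡ ∑[ x ← xs ] ∑[ y ← ys ] f (x , y)
∑-cartesianProduct [] ys f = refl
∑-cartesianProduct (x ∷ xs) ys f =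
  trans (∑-++ (map (x ,_) ys) (cartesianProduct xs ys) f) (cong₂ _+_ (∑-map (x ,_) ys f) (∑-cartesianProduct xs ys f))

∑-upTo-suc : ∀ n f → ∑ (upTo (suc n)) f ≡ f 0 + ∑[ k ← upTo n ] f (suc k)
∑-upTo-suc n f = cong (f 0 +_) (trans (cong (λ ks → ∑ ks f) (sym (map-upTo suc n))) (∑-map suc (upTo n) f))

∑-unique-sameElements : ∀ {xs ys : List A} f → Unique xs → Unique ys →
  (∀ {x} → x ∈ xs → x ∈ ys) → (∀ {x} → x ∈ ys → x ∈ xs) → ∑ xs f ≡ ∑ ys f
∑-unique-sameElements f xs! ys! to from = sum-↭ (↭-map⁺ f (∼bag⇒↭ (unique∧set⇒bag xs! ys! (mk⇔ to from))))

∑-𝟙-≟ : ∀ (_≟ᴬ_ : DecidableEquality A) u xs (h : A → ℕ) →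
  ∑[ y ← xs ] (𝟙 (does (u ≟ᴬ y)) * h y) ≡ (∑[ y ← xs ] 𝟙 (does (u ≟ᴬ y))) * h u
∑-𝟙-≟ _≟ᴬ_ u [] h = refl
∑-𝟙-≟ _≟ᴬ_ u (x ∷ xs) h with u ≟ᴬ x
... | yes refl = trans (cong (h u + 0 +_) (∑-𝟙-≟ _≟ᴬ_ u xs h)) (cong (_+ ∑[ y ← xs ] 𝟙 (does (u ≟ᴬ y)) * h u) (+-identityʳ (h u)))
... | no _ = ∑-𝟙-≟ _≟ᴬ_ u xs h

length-filterᵇ : ∀ (p : A → Bool) xs → length (filterᵇ p xs) ≡ ∑[ x ← xs ] 𝟙 (p x)
length-filterᵇ p [] = refl
length-filterᵇ p (x ∷ xs) with p x
... | true = cong suc (length-filterᵇ p xs)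
... | false = length-filterᵇ p xs

Unique-map⁺-on : ∀ {P : A → Set} (f : A → B) {xs} → Unique xs → All P xs →
  (∀ {x y} → P x → P y → f x ≡ f y → x ≡ y) → Unique (map f xs)
Unique-map⁺-on f [] [] inj = []
Unique-map⁺-on {P = P} f (x∉xs ∷ xs!) (px ∷ pxs) inj = distinct x∉xs pxs ∷ Unique-map⁺-on f xs! pxs inj
  where
  distinct : ∀ {ys} → All (_ ≢_) ys → All P ys → All (f _ ≢_) (map f ys)
  distinct [] [] = []
  distinct (x≢y ∷ x≢ys) (py ∷ pys) = (λ fx≡fy → x≢y (inj px py fx≡fy)) ∷ distinct x≢ys pys

sumS-map : ∀ (h : A → Series m) xs N M → sumS (map h xs) N M ≡ ∑[ x ← xs ] h x N M
sumS-map h [] N M = refl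
sumS-map h (x ∷ xs) N M = cong (h x N M +_) (sumS-map h xs N M)

-- The operations on exponent vectors used by _⊗_ (below x enumerates the u with u ≼ x);
-- their laws lift coordinatewise from ℕ to Vec ℕ m to Mono m N.
record Exponents (A : Set) : Set where
  infixl 6 _+ₑ_ _∸ₑ_
  field
    _+ₑ_ _∸ₑ_ : A → A → A
    _≼_ : A → A → Bool
    _≟ₑ_ : DecidableEquality A
    below : A → List A
    +ₑ-≡-split : ∀ a w x → does ((a +ₑ w) ≟ₑ x) ≡ a ≼ x ∧ does (w ≟ₑ (x ∸ₑ a))
    ≼-∸ₑ-swap : ∀ a b x → a ≼ x ∧ b ≼ (x ∸ₑ a) ≡ b ≼ x ∧ a ≼ (x ∸ₑ b)
    ∸ₑ-swap : ∀ a b x → x ∸ₑ a ∸ₑ b ≡ x ∸ₑ b ∸ₑ a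
    count-below : ∀ x u → ∑[ y ← below x ] 𝟙 (does (u ≟ₑ y)) ≡ 𝟙 (u ≼ x)

  ∑-below-pick : ∀ x u (h : A → ℕ) → ∑[ y ← below x ] (𝟙 (does (u ≟ₑ y)) * h y) ≡ 𝟙 (u ≼ x) * h u
  ∑-below-pick x u h = trans (∑-𝟙-≟ _≟ₑ_ u (below x) h) (cong (_* h u) (count-below x u))

≤ᵇ-suc : ∀ m n → (suc m ≤ᵇ suc n) ≡ (m ≤ᵇ n)
≤ᵇ-suc zero n = refl
≤ᵇ-suc (suc m) n = refl

+-≡⇔≤×≡∸ : ∀ {a w x} → (a + w ≡ x) ⇔ (a ≤ x × w ≡ x ∸ a)
+-≡⇔≤×≡∸ {a} {w} = mk⇔ (λ { refl → m≤m+n a w , sym (m+n∸m≡n a w) }) (λ { (a≤x , refl) → m+[n∸m]≡n a≤x })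

≤×≤∸-swap : ∀ {a b x} → a ≤ x × b ≤ x ∸ a → b ≤ x × a ≤ x ∸ b
≤×≤∸-swap {a} {b} {x} (a≤x , b≤x∸a) =
  ≤-trans (m≤m+n b a) b+a≤x , subst (_≤ x ∸ b) (m+n∸m≡n b a) (∸-monoˡ-≤ b b+a≤x)
  where
  b+a≤x : b + a ≤ x
  b+a≤x = subst (_≤ x) (+-comm a b) (subst (a + b ≤_) (m+[n∸m]≡n a≤x) (+-monoʳ-≤ a b≤x∸a))

count-upTo : ∀ n u → ∑[ y ← upTo (suc n) ] 𝟙 (does (u ≟ y)) ≡ 𝟙 (u ≤ᵇ n)
count-upTo n zero = trans (∑-upTo-suc n (λ y → 𝟙 (does (0 ≟ y)))) (cong suc (∑-zero (upTo n)))
count-upTo zero (suc u) = refl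
count-upTo (suc n) (suc u) = begin
  ∑[ y ← upTo (suc (suc n)) ] 𝟙 (does (suc u ≟ y))  ≡⟨ ∑-upTo-suc (suc n) (λ y → 𝟙 (does (suc u ≟ y))) ⟩
  ∑[ y ← upTo (suc n) ] 𝟙 (does (u ≟ y))            ≡⟨ count-upTo n u ⟩
  𝟙 (u ≤ᵇ n)                                         ≡⟨ cong 𝟙 (≤ᵇ-suc u n) ⟨
  𝟙 (suc u ≤ᵇ suc n)                                 ∎
  where open ≡-Reasoning

ℕ-exponents : Exponents ℕ
ℕ-exponents = record
  { _+ₑ_ = _+_
  ; _∸ₑ_ = _∸_
  ; _≼_ = _≤ᵇ_
  ; _≟ₑ_ = _≟_
  ; below = upTo ∘ suc
  ; +ₑ-≡-split = λ a w x → does-⇔ +-≡⇔≤×≡∸ (a + w ≟ x) (a ≤? x ×-dec w ≟ x ∸ a)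
  ; ≼-∸ₑ-swap = λ a b x → does-⇔ (mk⇔ ≤×≤∸-swap ≤×≤∸-swap) (a ≤? x ×-dec b ≤? x ∸ a) (b ≤? x ×-dec a ≤? x ∸ b)
  ; ∸ₑ-swap = λ a b x → trans (∸-+-assoc x a b) (trans (cong (x ∸_) (+-comm a b)) (sym (∸-+-assoc x b a)))
  ; count-below = count-upTo
  }

module Coordinatewise (E : Exponents A)
  (belowⱽ : ∀ {k} → Vec A k → List (Vec A k))
  (belowⱽ-[] : belowⱽ [] ≡ [] ∷ [])
  (belowⱽ-∷ : ∀ {k} x (xs : Vec A k) → belowⱽ (x ∷ xs) ≡ concatMap (λ y → map (y ∷_) (belowⱽ xs)) (Exponents.below E x))
  where

  open Exponents E

  _≼ⱽ_ : ∀ {k} → Vec A k → Vec A k → Bool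
  [] ≼ⱽ [] = true
  (a ∷ as) ≼ⱽ (x ∷ xs) = a ≼ x ∧ as ≼ⱽ xs

  private
    _+ⱽ_ _∸ⱽ_ : ∀ {k} → Vec A k → Vec A k → Vec A k
    _+ⱽ_ = Vec.zipWith _+ₑ_
    _∸ⱽ_ = Vec.zipWith _∸ₑ_

    _≟ⱽ_ : ∀ {k} → DecidableEquality (Vec A k)
    _≟ⱽ_ = Vecₚ.≡-dec _≟ₑ_

  +ⱽ-≡-split : ∀ {k} (a w x : Vec A k) → does ((a +ⱽ w) ≟ⱽ x) ≡ a ≼ⱽ x ∧ does (w ≟ⱽ (x ∸ⱽ a))
  +ⱽ-≡-split [] [] [] = refl
  +ⱽ-≡-split (a ∷ as) (w ∷ ws) (x ∷ xs) =
    trans (cong₂ _∧_ (+ₑ-≡-split a w x) (+ⱽ-≡-split as ws xs)) (∧-interchange (a ≼ x) _ (as ≼ⱽ xs) _)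

  ≼ⱽ-∸ⱽ-swap : ∀ {k} (a b x : Vec A k) → a ≼ⱽ x ∧ b ≼ⱽ (x ∸ⱽ a) ≡ b ≼ⱽ x ∧ a ≼ⱽ (x ∸ⱽ b)
  ≼ⱽ-∸ⱽ-swap [] [] [] = refl
  ≼ⱽ-∸ⱽ-swap (a ∷ as) (b ∷ bs) (x ∷ xs) = begin
    (a ≼ x ∧ as ≼ⱽ xs) ∧ (b ≼ (x ∸ₑ a) ∧ bs ≼ⱽ (xs ∸ⱽ as))  ≡⟨ ∧-interchange (a ≼ x) _ _ _ ⟩
    (a ≼ x ∧ b ≼ (x ∸ₑ a)) ∧ (as ≼ⱽ xs ∧ bs ≼ⱽ (xs ∸ⱽ as))  ≡⟨ cong₂ _∧_ (≼-∸ₑ-swap a b x) (≼ⱽ-∸ⱽ-swap as bs xs) ⟩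
    (b ≼ x ∧ a ≼ (x ∸ₑ b)) ∧ (bs ≼ⱽ xs ∧ as ≼ⱽ (xs ∸ⱽ bs))  ≡⟨ ∧-interchange (b ≼ x) _ _ _ ⟩
    (b ≼ x ∧ bs ≼ⱽ xs) ∧ (a ≼ (x ∸ₑ b) ∧ as ≼ⱽ (xs ∸ⱽ bs))  ∎
    where open ≡-Reasoning

  ∸ⱽ-swap : ∀ {k} (a b x : Vec A k) → (x ∸ⱽ a) ∸ⱽ b ≡ (x ∸ⱽ b) ∸ⱽ a
  ∸ⱽ-swap [] [] [] = refl
  ∸ⱽ-swap (a ∷ as) (b ∷ bs) (x ∷ xs) = cong₂ _∷_ (∸ₑ-swap a b x) (∸ⱽ-swap as bs xs)

  count-belowⱽ : ∀ {k} (x u : Vec A k) → ∑[ y ← belowⱽ x ] 𝟙 (does (u ≟ⱽ y)) ≡ 𝟙 (u ≼ⱽ x)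
  count-belowⱽ [] [] = cong (λ ys → ∑[ y ← ys ] 𝟙 (does ([] ≟ⱽ y))) belowⱽ-[]
  count-belowⱽ (x ∷ xs) (u ∷ us) = begin
    ∑[ y ← belowⱽ (x ∷ xs) ] 𝟙 (does ((u ∷ us) ≟ⱽ y))
      ≡⟨ cong (λ ys → ∑[ y ← ys ] 𝟙 (does ((u ∷ us) ≟ⱽ y))) (belowⱽ-∷ x xs) ⟩
    ∑ (concatMap (λ y → map (y ∷_) (belowⱽ xs)) (below x)) (λ y → 𝟙 (does ((u ∷ us) ≟ⱽ y)))
      ≡⟨ ∑-concatMap (λ y → map (y ∷_) (belowⱽ xs)) (below x) _ ⟩
    ∑[ y ← below x ] ∑[ ys ← map (y ∷_) (belowⱽ xs) ] 𝟙 (does ((u ∷ us) ≟ⱽ ys))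
      ≡⟨ ∑-cong (below x) (λ y → trans (∑-map (y ∷_) (belowⱽ xs) _) (∑-cong (belowⱽ xs) (λ ys → 𝟙-∧ (does (u ≟ₑ y)) _))) ⟩
    ∑[ y ← below x ] ∑[ ys ← belowⱽ xs ] (𝟙 (does (u ≟ₑ y)) * 𝟙 (does (us ≟ⱽ ys)))
      ≡⟨ ∑-cong (below x) (λ y → trans (∑-*ˡ (belowⱽ xs) (𝟙 (does (u ≟ₑ y))) (λ ys → 𝟙 (does (us ≟ⱽ ys))))
                                        (cong (𝟙 (does (u ≟ₑ y)) *_) (count-belowⱽ xs us))) ⟩
    ∑[ y ← below x ] (𝟙 (does (u ≟ₑ y)) * 𝟙 (us ≼ⱽ xs))
      ≡⟨ ∑-below-pick x u (λ _ → 𝟙 (us ≼ⱽ xs)) ⟩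
    𝟙 (u ≼ x) * 𝟙 (us ≼ⱽ xs)
      ≡⟨ 𝟙-∧ (u ≼ x) _ ⟨
    𝟙 (u ≼ x ∧ us ≼ⱽ xs) ∎
    where open ≡-Reasoning

  exponents : ∀ k → Exponents (Vec A k)
  exponents k = record
    { _+ₑ_ = _+ⱽ_
    ; _∸ₑ_ = _∸ⱽ_
    ; _≼_ = _≼ⱽ_
    ; _≟ₑ_ = _≟ⱽ_
    ; below = belowⱽ
    ; +ₑ-≡-split = +ⱽ-≡-split
    ; ≼-∸ₑ-swap = ≼ⱽ-∸ⱽ-swap
    ; ∸ₑ-swap = ∸ⱽ-swap
    ; count-below = count-belowⱽ
    }

rowExponents : ∀ m → Exponents (Vec ℕ m)
rowExponents = Coordinatewise.exponents ℕ-exponents belowVec refl (λ _ _ → refl)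

monoExponents : ∀ m N → Exponents (Mono m N)
monoExponents m = Coordinatewise.exponents (rowExponents m) belowMono refl (λ _ _ → refl)

module Monomial {m N : ℕ} = Exponents (monoExponents m N)
open Monomial

var : Fin m × Fin N → Mono m N
var x = monoOf (x ∷ [])

updateAt-as-zipWith : ∀ {n} {_∙_ : A → A → A} {e : A} → (∀ x → e ∙ x ≡ x) → ∀ (i : Fin n) (f g : A → A) →
  (∀ x → f x ≡ g e ∙ x) → ∀ v → Vec.updateAt v i f ≡ Vec.zipWith _∙_ (Vec.updateAt (Vec.replicate n e) i g) v
updateAt-as-zipWith idˡ zero f g f≗ge∙ (x ∷ v) = cong₂ _∷_ (f≗ge∙ x) (sym (Vecₚ.zipWith-identityˡ idˡ v))
updateAt-as-zipWith idˡ (suc i) f g f≗ge∙ (x ∷ v) = cong₂ _∷_ (sym (idˡ x)) (updateAt-as-zipWith idˡ i f g f≗ge∙ v)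

monoOf-∷ : ∀ (x : Fin m × Fin N) w → monoOf (x ∷ w) ≡ var x +ₑ monoOf w
monoOf-∷ (c , i) w = updateAt-as-zipWith (Vecₚ.zipWith-identityˡ (λ _ → refl)) i _ _
  (updateAt-as-zipWith (λ _ → refl) c suc suc (λ _ → refl)) (monoOf w)

-- A position of a composition: its colour j′ₛ and whether s ends a part.
Letter : ℕ → Set
Letter m = Fin m × Bool

-- A position together with the index i of its variable x_{c,i}.
Placed : ℕ → ℕ → Set
Placed m N = Fin m × Bool × Fin N

-- The condition admissible imposes on consecutive positions.
follows : Maybe (Placed m N) → Fin m × Fin N → Bool
follows nothing _ = true
follows (just (c₀ , f₀ , i₀)) (c , i) =
  (toℕ i₀ ≤ᵇ toℕ i) ∧ (if f₀ ∧ (toℕ c ≤ᵇ toℕ c₀) then toℕ i₀ <ᵇ toℕ i else true)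

-- The number of admissible choices of indices for the letters w after the position p, with monomial M.
fillings : Maybe (Placed m N) → List (Letter m) → Mono m N → ℕ
fillings p [] M = 𝟙 (does (zeroMono ≟ₑ M))
fillings {N = N} p ((c , f) ∷ w) M =
  ∑[ i ← allFin N ] (𝟙 (follows p (c , i)) * (𝟙 (var (c , i) ≼ M) * fillings (just (c , f , i)) w (M ∸ₑ var (c , i))))

admissible-∷ : ∀ (p : Maybe (Placed m N)) c f i r → admissible (fromMaybe p ++ (c , f , i) ∷ r) ≡ follows p (c , i) ∧ admissible ((c , f , i) ∷ r)
admissible-∷ nothing c f i r = refl
admissible-∷ (just (c₀ , f₀ , i₀)) c f i r = sym (∧-assoc (toℕ i₀ ≤ᵇ toℕ i) _ _)

𝟙-∧-∧ : ∀ a b c d → 𝟙 ((a ∧ b) ∧ (c ∧ d)) ≡ 𝟙 a * (𝟙 c * 𝟙 (b ∧ d))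
𝟙-∧-∧ a b c d = begin
  𝟙 ((a ∧ b) ∧ (c ∧ d))  ≡⟨ cong 𝟙 (trans (∧-interchange a b c d) (∧-assoc a c (b ∧ d))) ⟩
  𝟙 (a ∧ (c ∧ (b ∧ d)))  ≡⟨ trans (𝟙-∧ a _) (cong (𝟙 a *_) (𝟙-∧ c (b ∧ d))) ⟩
  𝟙 a * (𝟙 c * 𝟙 (b ∧ d)) ∎
  where open ≡-Reasoning

count-admissible : ∀ (p : Maybe (Placed m N)) cs fs M → length cs ≡ length fs →
  ∑[ is ← allSeqs N (length cs) ] 𝟙 (admissible (fromMaybe p ++ zip cs (zip fs is)) ∧ does (monoOf (zip cs is) ≟ₑ M))
    ≡ fillings p (zip cs fs) M
count-admissible nothing [] [] M _ = +-identityʳ _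
count-admissible (just _) [] [] M _ = +-identityʳ _
count-admissible {N = N} p (c ∷ cs) (f ∷ fs) M len≡ = begin
  ∑ (concatMap (λ i → map (i ∷_) (allSeqs N (length cs))) (allFin N)) term
    ≡⟨ ∑-concatMap (λ i → map (i ∷_) (allSeqs N (length cs))) (allFin N) term ⟩
  ∑[ i ← allFin N ] ∑ (map (i ∷_) (allSeqs N (length cs))) term
    ≡⟨ ∑-cong (allFin N) (λ i → trans (∑-map (i ∷_) (allSeqs N (length cs)) term) (∑-cong (allSeqs N (length cs)) (split i))) ⟩
  ∑[ i ← allFin N ] ∑[ is ← allSeqs N (length cs) ] (𝟙 (follows p (c , i)) * (𝟙 (var (c , i) ≼ M) * rest i is))
    ≡⟨ ∑-cong (allFin N) (λ i → ∑-*ˡ₂ (allSeqs N (length cs)) (𝟙 (follows p (c , i))) (𝟙 (var (c , i) ≼ M)) (rest i)) ⟩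
  ∑[ i ← allFin N ] (𝟙 (follows p (c , i)) * (𝟙 (var (c , i) ≼ M) * ∑[ is ← allSeqs N (length cs) ] rest i is))
    ≡⟨ ∑-cong (allFin N) (λ i → cong (λ n → 𝟙 (follows p (c , i)) * (𝟙 (var (c , i) ≼ M) * n))
                                      (count-admissible (just (c , f , i)) cs fs (M ∸ₑ var (c , i)) (suc-injective len≡))) ⟩
  fillings p ((c , f) ∷ zip cs fs) M ∎
  where
  open ≡-Reasoning
  term : List (Fin N) → ℕ
  term is = 𝟙 (admissible (fromMaybe p ++ zip (c ∷ cs) (zip (f ∷ fs) is)) ∧ does (monoOf (zip (c ∷ cs) is) ≟ₑ M))
  rest : Fin N → List (Fin N) → ℕ
  rest i is = 𝟙 (admissible ((c , f , i) ∷ zip cs (zip fs is)) ∧ does (monoOf (zip cs is) ≟ₑ (M ∸ₑ var (c , i))))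
  split : ∀ i is → term (i ∷ is) ≡ 𝟙 (follows p (c , i)) * (𝟙 (var (c , i) ≼ M) * rest i is)
  split i is = begin
    term (i ∷ is)
      ≡⟨ cong₂ (λ a e → 𝟙 (a ∧ e)) (admissible-∷ p c f i (zip cs (zip fs is)))
                                   (trans (cong (λ X → does (X ≟ₑ M)) (monoOf-∷ (c , i) (zip cs is))) (+ₑ-≡-split (var (c , i)) _ M)) ⟩
    𝟙 ((follows p (c , i) ∧ admissible ((c , f , i) ∷ zip cs (zip fs is))) ∧ (var (c , i) ≼ M ∧ does (monoOf (zip cs is) ≟ₑ (M ∸ₑ var (c , i)))))
      ≡⟨ 𝟙-∧-∧ (follows p (c , i)) (admissible ((c , f , i) ∷ zip cs (zip fs is))) (var (c , i) ≼ M) _ ⟩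
    𝟙 (follows p (c , i)) * (𝟙 (var (c , i) ≼ M) * rest i is) ∎

partLetters : Fin m × ℕ → List (Letter m)
partLetters (c , a) = zip (replicate a c) (partEndFlags a)

word : ColComp m → List (Letter m)
word = concatMap partLetters

zip-++ : ∀ (xs : List A) (ys : List B) {xs′ ys′} → length xs ≡ length ys → zip (xs ++ xs′) (ys ++ ys′) ≡ zip xs ys ++ zip xs′ ys′
zip-++ [] [] _ = refl
zip-++ (x ∷ xs) (y ∷ ys) len≡ = cong ((x , y) ∷_) (zip-++ xs ys (suc-injective len≡))

length-partEndFlags : ∀ a → length (partEndFlags a) ≡ a
length-partEndFlags zero = refl
length-partEndFlags (suc a) = trans (length-++ (replicate a false)) (trans (cong (_+ 1) (length-replicate a)) (+-comm a 1))

zip-colorSeq-endFlags : ∀ (α : ColComp m) → zip (colorSeq α) (endFlags α) ≡ word α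
zip-colorSeq-endFlags [] = refl
zip-colorSeq-endFlags ((c , a) ∷ α) =
  trans (zip-++ (replicate a c) (partEndFlags a) (trans (length-replicate a) (sym (length-partEndFlags a))))
        (cong (partLetters (c , a) ++_) (zip-colorSeq-endFlags α))

length-colorSeq : ∀ (α : ColComp m) → length (colorSeq α) ≡ length (endFlags α)
length-colorSeq [] = refl
length-colorSeq ((c , a) ∷ α) = trans (length-++ (replicate a c))
  (trans (cong₂ _+_ (trans (length-replicate a) (sym (length-partEndFlags a))) (length-colorSeq α)) (sym (length-++ (partEndFlags a))))

L-fillings : ∀ (α : ColComp m) N M → L α N M ≡ fillings nothing (word α) M
L-fillings α N M = begin
  L α N M
    ≡⟨ length-filterᵇ _ (allSeqs N (length (colorSeq α))) ⟩
  ∑[ is ← allSeqs N (length (colorSeq α)) ] 𝟙 (admissible (zip (colorSeq α) (zip (endFlags α) is)) ∧ ⌊ monoOf (zip (colorSeq α) is) ≟ₑ M ⌋)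
    ≡⟨ ∑-cong (allSeqs N (length (colorSeq α))) (λ is → cong (λ b → 𝟙 (admissible (zip (colorSeq α) (zip (endFlags α) is)) ∧ b))
                                                             (isYes≗does (monoOf (zip (colorSeq α) is) ≟ₑ M))) ⟩
  ∑[ is ← allSeqs N (length (colorSeq α)) ] 𝟙 (admissible (zip (colorSeq α) (zip (endFlags α) is)) ∧ does (monoOf (zip (colorSeq α) is) ≟ₑ M))
    ≡⟨ count-admissible nothing (colorSeq α) (endFlags α) M (length-colorSeq α) ⟩
  fillings nothing (zip (colorSeq α) (endFlags α)) M
    ≡⟨ cong (λ w → fillings nothing w M) (zip-colorSeq-endFlags α) ⟩
  fillings nothing (word α) M ∎
  where open ≡-Reasoning

infix 4 _<ₗ_ _≤ₗ_

_<ₗ_ _≤ₗ_ : ℕ × ℕ → ℕ × ℕ → Set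
(i , c) <ₗ (i′ , c′) = i < i′ ⊎ (i ≡ i′ × c < c′)
(i , c) ≤ₗ (i′ , c′) = i < i′ ⊎ (i ≡ i′ × c ≤ c′)

<ₗ⇒≤ₗ : ∀ {x y} → x <ₗ y → x ≤ₗ y
<ₗ⇒≤ₗ (inj₁ i<i′) = inj₁ i<i′
<ₗ⇒≤ₗ (inj₂ (i≡i′ , c<c′)) = inj₂ (i≡i′ , <⇒≤ c<c′)

≤ₗ-<ₗ-trans : ∀ {x y z} → x ≤ₗ y → y <ₗ z → x <ₗ z
≤ₗ-<ₗ-trans (inj₁ p) (inj₁ q) = inj₁ (<-trans p q)
≤ₗ-<ₗ-trans (inj₁ p) (inj₂ (refl , _)) = inj₁ p
≤ₗ-<ₗ-trans (inj₂ (refl , _)) (inj₁ q) = inj₁ q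
≤ₗ-<ₗ-trans (inj₂ (refl , p)) (inj₂ (refl , q)) = inj₂ (refl , ≤-<-trans p q)

≤ₗ-trans : ∀ {x y z} → x ≤ₗ y → y ≤ₗ z → x ≤ₗ z
≤ₗ-trans (inj₁ p) (inj₁ q) = inj₁ (<-trans p q)
≤ₗ-trans (inj₁ p) (inj₂ (refl , _)) = inj₁ p
≤ₗ-trans (inj₂ (refl , _)) (inj₁ q) = inj₁ q
≤ₗ-trans (inj₂ (refl , p)) (inj₂ (refl , q)) = inj₂ (refl , ≤-trans p q)

≮ₗ⇒≥ₗ : ∀ x y → ¬ x <ₗ y → y ≤ₗ x
≮ₗ⇒≥ₗ (i , c) (i′ , c′) x≮y with <-cmp i i′
... | tri< i<i′ _ _ = ⊥-elim (x≮y (inj₁ i<i′))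
... | tri> _ _ i>i′ = inj₁ i>i′
... | tri≈ _ refl _ with <-cmp c c′
...   | tri< c<c′ _ _ = ⊥-elim (x≮y (inj₂ (refl , c<c′)))
...   | tri≈ _ refl _ = inj₂ (refl , ≤-refl)
...   | tri> _ _ c>c′ = inj₂ (refl , <⇒≤ c>c′)

≤ₗ⇒≯ₗ : ∀ {x y} → x ≤ₗ y → ¬ y <ₗ x
≤ₗ⇒≯ₗ (inj₁ p) (inj₁ q) = <-asym p q
≤ₗ⇒≯ₗ (inj₁ p) (inj₂ (refl , _)) = <-irrefl refl p
≤ₗ⇒≯ₗ (inj₂ (refl , _)) (inj₁ q) = <-irrefl refl q
≤ₗ⇒≯ₗ (inj₂ (refl , p)) (inj₂ (_ , q)) = <⇒≱ q p

≤⇔≤ₗ : ∀ {i i′ c} → i ≤ i′ ⇔ (i , c) ≤ₗ (i′ , c)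
≤⇔≤ₗ = mk⇔ (λ i≤i′ → [ inj₁ , (λ i≡i′ → inj₂ (i≡i′ , ≤-refl)) ]′ (m≤n⇒m<n∨m≡n i≤i′))
           (λ { (inj₁ i<i′) → <⇒≤ i<i′ ; (inj₂ (refl , _)) → ≤-refl })

≤ₗ⇒<ₗ : ∀ {i i′ c c′} → c ≢ c′ → (i , c) ≤ₗ (i′ , c′) → (i , c) <ₗ (i′ , c′)
≤ₗ⇒<ₗ c≢c′ (inj₁ i<i′) = inj₁ i<i′
≤ₗ⇒<ₗ c≢c′ (inj₂ (i≡i′ , c≤c′)) with m≤n⇒m<n∨m≡n c≤c′
... | inj₁ c<c′ = inj₂ (i≡i′ , c<c′)
... | inj₂ c≡c′ = ⊥-elim (c≢c′ c≡c′)

<ₗ⇔≤ᵇ∧<ᵇ : ∀ {i₀ c₀ i c} → T ((i₀ ≤ᵇ i) ∧ (if c ≤ᵇ c₀ then i₀ <ᵇ i else true)) ⇔ (i₀ , c₀) <ₗ (i , c)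
<ₗ⇔≤ᵇ∧<ᵇ {i₀} {c₀} {i} {c} = mk⇔ forth back
  where
  forth : T ((i₀ ≤ᵇ i) ∧ (if c ≤ᵇ c₀ then i₀ <ᵇ i else true)) → (i₀ , c₀) <ₗ (i , c)
  forth t with <-cmp i₀ i | T-∧ .to t
  ... | tri< i₀<i _ _ | _ = inj₁ i₀<i
  ... | tri> _ _ i₀>i | i₀≤i , _ = ⊥-elim (<⇒≱ i₀>i (≤ᵇ⇒≤ i₀ i i₀≤i))
  ... | tri≈ _ refl _ | _ , t′ with c ≤ᵇ c₀ in c≤c₀
  ...   | true = ⊥-elim (<-irrefl refl (<ᵇ⇒< i₀ i₀ t′))
  ...   | false = inj₂ (refl , ≰⇒> (λ c≤c₀′ → subst T c≤c₀ (≤⇒≤ᵇ c≤c₀′)))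
  back : (i₀ , c₀) <ₗ (i , c) → T ((i₀ ≤ᵇ i) ∧ (if c ≤ᵇ c₀ then i₀ <ᵇ i else true))
  back (inj₁ i₀<i) = T-∧ .from (≤⇒≤ᵇ (<⇒≤ i₀<i) , strict (c ≤ᵇ c₀))
    where
    strict : ∀ b → T (if b then i₀ <ᵇ i else true)
    strict true = <⇒<ᵇ i₀<i
    strict false = tt
  back (inj₂ (refl , c₀<c)) = T-∧ .from (≤⇒≤ᵇ (≤-refl {i₀}) , strict (c ≤ᵇ c₀) refl)
    where
    strict : ∀ b → (c ≤ᵇ c₀) ≡ b → T (if b then i₀ <ᵇ i₀ else true)
    strict true c≤c₀ = ⊥-elim (<⇒≱ c₀<c (≤ᵇ⇒≤ c c₀ (subst T (sym c≤c₀) tt)))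
    strict false _ = tt

follows-end : ∀ {c₀ i₀ c i} → T (follows {m} {N} (just (c₀ , true , i₀)) (c , i)) ⇔ (toℕ i₀ , toℕ c₀) <ₗ (toℕ i , toℕ c)
follows-end = <ₗ⇔≤ᵇ∧<ᵇ

follows-inner : ∀ {c₀ i₀ c i} → T (follows {m} {N} (just (c₀ , false , i₀)) (c , i)) ⇔ toℕ i₀ ≤ toℕ i
follows-inner = mk⇔ (λ t → ≤ᵇ⇒≤ _ _ (subst T (∧-identityʳ _) t)) (λ i₀≤i → T-∧ .from (≤⇒≤ᵇ i₀≤i , tt))

_≢ᵇ_ : Fin m → Fin m → Bool
c ≢ᵇ ε = not (does (c Fin.≟ ε))

-- A position of colour c followed by a new part (ε 1) ends its own part iff c ≢ ε;
-- if c = ε the new letter just prolongs the part.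
reflag : Fin m → Placed m N → Placed m N
reflag ε (c , _ , i) = c , c ≢ᵇ ε , i

Continues : Letter m → Letter m → Set
Continues (c₀ , f₀) (c , _) = f₀ ≡ false → c₀ ≡ c

unplace : Placed m N → Letter m
unplace (c , f , _) = c , f

ContinuesFrom : Maybe (Placed m N) → Letter m → Set
ContinuesFrom nothing _ = ⊤
ContinuesFrom (just x) y = Continues (unplace x) y

follows-reflag : ∀ {ε c₀ f₀ i₀ i} → T (follows {m} {N} (just (reflag ε (c₀ , f₀ , i₀))) (ε , i)) ⇔ (toℕ i₀ , toℕ c₀) ≤ₗ (toℕ i , toℕ ε)
follows-reflag {ε = ε} {c₀} {i₀ = i₀} {i} with c₀ Fin.≟ ε
... | yes refl = ⇔.trans (follows-inner {c₀ = ε} {i₀} {ε} {i}) ≤⇔≤ₗ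
... | no c₀≢ε = mk⇔ (<ₗ⇒≤ₗ ∘ follows-end .to) (follows-end .from ∘ ≤ₗ⇒<ₗ (c₀≢ε ∘ toℕ-injective))

follows⇒≤ₗ : ∀ {c₀ f₀ i₀ c i} → (f₀ ≡ false → c₀ ≡ c) →
  T (follows {m} {N} (just (c₀ , f₀ , i₀)) (c , i)) → (toℕ i₀ , toℕ c₀) ≤ₗ (toℕ i , toℕ c)
follows⇒≤ₗ {f₀ = true} _ t = <ₗ⇒≤ₗ (follows-end .to t)
follows⇒≤ₗ {c₀ = c₀} {false} {i₀} {i = i} c₀≡c t rewrite c₀≡c refl = ≤⇔≤ₗ .to (follows-inner {c₀ = c₀} {i₀} {c₀} {i} .to t)

<ₗ⇒follows : ∀ {c₀ f₀ i₀ c i} → (toℕ i₀ , toℕ c₀) <ₗ (toℕ i , toℕ c) → T (follows {m} {N} (just (c₀ , f₀ , i₀)) (c , i))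
<ₗ⇒follows {f₀ = true} lt = follows-end .from lt
<ₗ⇒follows {c₀ = c₀} {false} {i₀} {c} {i} lt = follows-inner {c₀ = c₀} {i₀} {c} {i} .from (≤ₗ⇒≤ (<ₗ⇒≤ₗ lt))
  where
  ≤ₗ⇒≤ : ∀ {i c i′ c′} → (i , c) ≤ₗ (i′ , c′) → i ≤ i′
  ≤ₗ⇒≤ (inj₁ i<i′) = <⇒≤ i<i′
  ≤ₗ⇒≤ (inj₂ (refl , _)) = ≤-refl

follows-trans : ∀ (p : Maybe (Placed m N)) {ε i c i₁} →
  T (follows (Maybe.map (reflag ε) p) (ε , i)) → T (follows (just (ε , true , i)) (c , i₁)) → T (follows p (c , i₁))
follows-trans nothing _ _ = tt
follows-trans (just (c₀ , f₀ , i₀)) {ε} {i} {c} {i₁} ε-after-p c-after-ε =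
  <ₗ⇒follows {c₀ = c₀} {f₀} {i₀} {c} {i₁}
    (≤ₗ-<ₗ-trans (follows-reflag {ε = ε} {c₀} {f₀} {i₀} {i} .to ε-after-p) (follows-end {c₀ = ε} {i} {c} {i₁} .to c-after-ε))

follows-exchange : ∀ (p : Maybe (Placed m N)) {ε i c f i₁} → ContinuesFrom p (c , f) → T (follows p (c , i₁)) →
  T (follows (just (reflag ε (c , f , i₁))) (ε , i))
    ⇔ (T (follows (Maybe.map (reflag ε) p) (ε , i)) × ¬ T (follows (just (ε , true , i)) (c , i₁)))
follows-exchange p {ε} {i} {c} {f} {i₁} continues c-after-p = mk⇔ forth back
  where
  forth : T (follows (just (reflag ε (c , f , i₁))) (ε , i)) → T (follows (Maybe.map (reflag ε) p) (ε , i)) × ¬ T (follows (just (ε , true , i)) (c , i₁))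
  forth ε-after-c = ε-after-p p continues c-after-p , ≤ₗ⇒≯ₗ c≤ε ∘ follows-end {c₀ = ε} {i} {c} {i₁} .to
    where
    c≤ε : (toℕ i₁ , toℕ c) ≤ₗ (toℕ i , toℕ ε)
    c≤ε = follows-reflag {ε = ε} {c} {f} {i₁} {i} .to ε-after-c
    ε-after-p : ∀ p → ContinuesFrom p (c , f) → T (follows p (c , i₁)) → T (follows (Maybe.map (reflag ε) p) (ε , i))
    ε-after-p nothing _ _ = tt
    ε-after-p (just (c₀ , f₀ , i₀)) continues c-after-p =
      follows-reflag {ε = ε} {c₀} {f₀} {i₀} {i} .from (≤ₗ-trans (follows⇒≤ₗ {c₀ = c₀} {f₀} {i₀} {c} {i₁} continues c-after-p) c≤ε)
  back : T (follows (Maybe.map (reflag ε) p) (ε , i)) × ¬ T (follows (just (ε , true , i)) (c , i₁)) → T (follows (just (reflag ε (c , f , i₁))) (ε , i))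
  back (_ , c-not-after-ε) = follows-reflag {ε = ε} {c} {f} {i₁} {i} .from
    (≮ₗ⇒≥ₗ (toℕ i , toℕ ε) (toℕ i₁ , toℕ c) (c-not-after-ε ∘ follows-end {c₀ = ε} {i} {c} {i₁} .from))

𝟙-split : ∀ a b c a′ → (T a → T c → T b) → (T b → T a′ ⇔ (T a × ¬ T c)) → 𝟙 a * 𝟙 b ≡ 𝟙 a * 𝟙 c + 𝟙 b * 𝟙 a′
𝟙-split false false c a′ _ _ = refl
𝟙-split false true c false _ _ = refl
𝟙-split false true c true _ a′⇔ = ⊥-elim (a′⇔ tt .to tt .proj₁)
𝟙-split true false true a′ a⇒c⇒b _ = ⊥-elim (a⇒c⇒b tt tt)
𝟙-split true true true false _ _ = refl
𝟙-split true true true true _ a′⇔ = ⊥-elim (a′⇔ tt .to tt .proj₂ tt)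
𝟙-split true false false a′ _ _ = refl
𝟙-split true true false true _ _ = refl
𝟙-split true true false false _ a′⇔ = ⊥-elim (a′⇔ tt .from (tt , λ ()))

regroup : ∀ a b x y z → a * (x * (b * (y * z))) ≡ a * b * (x * y * z)
regroup = solve-∀

insertion-split : ∀ {a b c a′} x y z u R R′ → (T a → T c → T b) → (T b → T a′ ⇔ (T a × ¬ T c)) → x * y ≡ z * u → R ≡ R′ →
  𝟙 a * (x * (𝟙 b * (y * R))) ≡ 𝟙 a * (x * (𝟙 c * (y * R))) + 𝟙 b * (z * (𝟙 a′ * (u * R′)))
insertion-split {a} {b} {c} {a′} x y z u R R′ a⇒c⇒b a′⇔ xy≡zu R≡R′ = begin
  𝟙 a * (x * (𝟙 b * (y * R)))                            ≡⟨ regroup (𝟙 a) (𝟙 b) x y R ⟩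
  𝟙 a * 𝟙 b * (x * y * R)                                ≡⟨ cong (_* (x * y * R)) (𝟙-split a b c a′ a⇒c⇒b a′⇔) ⟩
  (𝟙 a * 𝟙 c + 𝟙 b * 𝟙 a′) * (x * y * R)                 ≡⟨ *-distribʳ-+ (x * y * R) (𝟙 a * 𝟙 c) (𝟙 b * 𝟙 a′) ⟩
  𝟙 a * 𝟙 c * (x * y * R) + 𝟙 b * 𝟙 a′ * (x * y * R)     ≡⟨ cong₂ (λ v R″ → 𝟙 a * 𝟙 c * (x * y * R) + 𝟙 b * 𝟙 a′ * (v * R″)) xy≡zu R≡R′ ⟩
  𝟙 a * 𝟙 c * (x * y * R) + 𝟙 b * 𝟙 a′ * (z * u * R′)    ≡⟨ cong₂ _+_ (regroup (𝟙 a) (𝟙 c) x y R) (regroup (𝟙 b) (𝟙 a′) z u R′) ⟨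
  𝟙 a * (x * (𝟙 c * (y * R))) + 𝟙 b * (z * (𝟙 a′ * (u * R′))) ∎
  where open ≡-Reasoning

-- Inserts (ε , true) after the first g letters, reflagging the g-th one; only used with g ≤ length w.
insertAfter : Fin m → ℕ → List (Letter m) → List (Letter m)
insertAfter ε zero w = (ε , true) ∷ w
insertAfter ε (suc g) [] = (ε , true) ∷ []
insertAfter ε (suc zero) ((c , f) ∷ w) = (c , c ≢ᵇ ε) ∷ (ε , true) ∷ w
insertAfter ε (suc (suc g)) (x ∷ w) = x ∷ insertAfter ε (suc g) w

-- The coefficient of M in (∑_{ε,i} x_{ε,i}) · fillings p w, where x_{ε,i} must also be admissible after p.
-- For p = nothing this is (∑_ε L_(ε1)) L; the general p is what makes the induction on w go through.
productCount : Maybe (Placed m N) → List (Letter m) → Mono m N → ℕ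
productCount {m = m} {N = N} p w M =
  ∑[ ε ← allFin m ] ∑[ i ← allFin N ] (𝟙 (follows (Maybe.map (reflag ε) p) (ε , i)) * (𝟙 (var (ε , i) ≼ M) * fillings p w (M ∸ₑ var (ε , i))))

insertionCount : Fin m → Maybe (Placed m N) → List (Letter m) → Mono m N → ℕ
insertionCount ε p w M = fillings (Maybe.map (reflag ε) p) ((ε , true) ∷ w) M + ∑[ g ← upTo (length w) ] fillings p (insertAfter ε (suc g) w) M

fillings-insertAfter-∷ : ∀ (p : Maybe (Placed m N)) ε c f w M →
  ∑[ g ← upTo (length ((c , f) ∷ w)) ] fillings p (insertAfter ε (suc g) ((c , f) ∷ w)) M
    ≡ ∑[ i ← allFin N ] (𝟙 (follows p (c , i)) * (𝟙 (var (c , i) ≼ M) * insertionCount ε (just (c , f , i)) w (M ∸ₑ var (c , i))))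
fillings-insertAfter-∷ {N = N} p ε c f w M = begin
  ∑[ g ← upTo (suc (length w)) ] fillings p (insertAfter ε (suc g) ((c , f) ∷ w)) M
    ≡⟨ ∑-upTo-suc (length w) (λ g → fillings p (insertAfter ε (suc g) ((c , f) ∷ w)) M) ⟩
  fillings p ((c , c ≢ᵇ ε) ∷ (ε , true) ∷ w) M + ∑[ g ← upTo (length w) ] fillings p ((c , f) ∷ insertAfter ε (suc g) w) M
    ≡⟨ cong (fillings p ((c , c ≢ᵇ ε) ∷ (ε , true) ∷ w) M +_) (∑-comm (upTo (length w)) (allFin N) _) ⟩
  ∑[ i ← allFin N ] (p⇝c i * (c∣M i * now i)) + ∑[ i ← allFin N ] ∑[ g ← upTo (length w) ] (p⇝c i * (c∣M i * later i g))
    ≡⟨ cong (∑[ i ← allFin N ] (p⇝c i * (c∣M i * now i)) +_) (∑-cong (allFin N) (λ i → ∑-*ˡ₂ (upTo (length w)) (p⇝c i) (c∣M i) (later i))) ⟩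
  ∑[ i ← allFin N ] (p⇝c i * (c∣M i * now i)) + ∑[ i ← allFin N ] (p⇝c i * (c∣M i * ∑[ g ← upTo (length w) ] later i g))
    ≡⟨ ∑-+ (allFin N) _ _ ⟨
  ∑[ i ← allFin N ] (p⇝c i * (c∣M i * now i) + p⇝c i * (c∣M i * ∑[ g ← upTo (length w) ] later i g))
    ≡⟨ ∑-cong (allFin N) (λ i → trans (sym (*-distribˡ-+ (p⇝c i) _ _)) (cong (p⇝c i *_) (sym (*-distribˡ-+ (c∣M i) _ _)))) ⟩
  ∑[ i ← allFin N ] (p⇝c i * (c∣M i * insertionCount ε (just (c , f , i)) w (M ∸ₑ var (c , i)))) ∎
  where
  open ≡-Reasoning
  p⇝c c∣M : Fin N → ℕ
  p⇝c i = 𝟙 (follows p (c , i))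
  c∣M i = 𝟙 (var (c , i) ≼ M)
  now : Fin N → ℕ
  now i = fillings (just (c , c ≢ᵇ ε , i)) ((ε , true) ∷ w) (M ∸ₑ var (c , i))
  later : Fin N → ℕ → ℕ
  later i g = fillings (just (c , f , i)) (insertAfter ε (suc g) w) (M ∸ₑ var (c , i))

linked-uncons : ∀ (p : Maybe (Placed m N)) {x w} → Linked Continues (fromMaybe (Maybe.map unplace p) ++ x ∷ w) →
  ContinuesFrom p x × Linked Continues (x ∷ w)
linked-uncons nothing linked = tt , linked
linked-uncons (just _) (continues ∷ linked) = continues , linked

-- Each term splits according to whether x_{ε,i} comes before x_{c,i₁} (εFirst) or after it (cFirst);
-- the latter terms add up to the same product for the shorter word w.
productCount-∷ : ∀ (p : Maybe (Placed m N)) c f w M → ContinuesFrom p (c , f) →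
  productCount p ((c , f) ∷ w) M
    ≡ ∑[ ε ← allFin m ] fillings (Maybe.map (reflag ε) p) ((ε , true) ∷ (c , f) ∷ w) M
      + ∑[ i₁ ← allFin N ] (𝟙 (follows p (c , i₁)) * (𝟙 (var (c , i₁) ≼ M) * productCount (just (c , f , i₁)) w (M ∸ₑ var (c , i₁))))
productCount-∷ {m = m} {N = N} p c f w M continues = begin
  productCount p ((c , f) ∷ w) M
    ≡⟨ ∑-cong (allFin m) (λ ε → ∑-cong (allFin N) (λ i → sym (∑-*ˡ₂ (allFin N) (p⇝ε ε i) (ε∣M ε i) (λ i₁ → p⇝c i₁ * (c∣M/ε ε i i₁ * rest ε i i₁))))) ⟩
  ∑[ ε ← allFin m ] ∑[ i ← allFin N ] ∑[ i₁ ← allFin N ] (p⇝ε ε i * (ε∣M ε i * (p⇝c i₁ * (c∣M/ε ε i i₁ * rest ε i i₁))))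
    ≡⟨ ∑-cong (allFin m) (λ ε → ∑-cong (allFin N) (λ i → ∑-cong (allFin N) (split ε i))) ⟩
  ∑[ ε ← allFin m ] ∑[ i ← allFin N ] ∑[ i₁ ← allFin N ] (εFirst ε i i₁ + cFirst ε i i₁)
    ≡⟨ trans (∑-cong (allFin m) (λ ε → trans (∑-cong (allFin N) (λ i → ∑-+ (allFin N) (εFirst ε i) (cFirst ε i))) (∑-+ (allFin N) _ _)))
             (∑-+ (allFin m) _ _) ⟩
  ∑[ ε ← allFin m ] ∑[ i ← allFin N ] ∑[ i₁ ← allFin N ] εFirst ε i i₁
    + ∑[ ε ← allFin m ] ∑[ i ← allFin N ] ∑[ i₁ ← allFin N ] cFirst ε i i₁
    ≡⟨ cong₂ _+_ (∑-cong (allFin m) (λ ε → ∑-cong (allFin N) (λ i → ∑-*ˡ₂ (allFin N) (p⇝ε ε i) (ε∣M ε i) (λ i₁ → ε⇝c ε i i₁ * (c∣M/ε ε i i₁ * rest ε i i₁)))))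
                 (trans (trans (∑-cong (allFin m) (λ ε → ∑-comm (allFin N) (allFin N) (cFirst ε))) (∑-comm (allFin m) (allFin N) _))
                        (∑-cong (allFin N) (λ i₁ → trans (∑-cong (allFin m) (λ ε → ∑-*ˡ₂ (allFin N) (p⇝c i₁) (c∣M i₁) _))
                                                          (∑-*ˡ₂ (allFin m) (p⇝c i₁) (c∣M i₁) _)))) ⟩
  ∑[ ε ← allFin m ] fillings (Maybe.map (reflag ε) p) ((ε , true) ∷ (c , f) ∷ w) M
    + ∑[ i₁ ← allFin N ] (p⇝c i₁ * (c∣M i₁ * productCount (just (c , f , i₁)) w (M ∸ₑ var (c , i₁)))) ∎
  where
  open ≡-Reasoning
  p⇝ε ε∣M : Fin m → Fin N → ℕ
  p⇝ε ε i = 𝟙 (follows (Maybe.map (reflag ε) p) (ε , i))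
  ε∣M ε i = 𝟙 (var (ε , i) ≼ M)
  p⇝c c∣M : Fin N → ℕ
  p⇝c i₁ = 𝟙 (follows p (c , i₁))
  c∣M i₁ = 𝟙 (var (c , i₁) ≼ M)
  ε⇝c c∣M/ε rest c⇝ε ε∣M/c rest′ εFirst cFirst : Fin m → Fin N → Fin N → ℕ
  ε⇝c ε i i₁ = 𝟙 (follows (just (ε , true , i)) (c , i₁))
  c∣M/ε ε i i₁ = 𝟙 (var (c , i₁) ≼ (M ∸ₑ var (ε , i)))
  rest ε i i₁ = fillings (just (c , f , i₁)) w (M ∸ₑ var (ε , i) ∸ₑ var (c , i₁))
  c⇝ε ε i i₁ = 𝟙 (follows (just (reflag ε (c , f , i₁))) (ε , i))
  ε∣M/c ε i i₁ = 𝟙 (var (ε , i) ≼ (M ∸ₑ var (c , i₁)))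
  rest′ ε i i₁ = fillings (just (c , f , i₁)) w (M ∸ₑ var (c , i₁) ∸ₑ var (ε , i))
  εFirst ε i i₁ = p⇝ε ε i * (ε∣M ε i * (ε⇝c ε i i₁ * (c∣M/ε ε i i₁ * rest ε i i₁)))
  cFirst ε i i₁ = p⇝c i₁ * (c∣M i₁ * (c⇝ε ε i i₁ * (ε∣M/c ε i i₁ * rest′ ε i i₁)))
  split : ∀ ε i i₁ → p⇝ε ε i * (ε∣M ε i * (p⇝c i₁ * (c∣M/ε ε i i₁ * rest ε i i₁))) ≡ εFirst ε i i₁ + cFirst ε i i₁
  split ε i i₁ = insertion-split (ε∣M ε i) (c∣M/ε ε i i₁) (c∣M i₁) (ε∣M/c ε i i₁) (rest ε i i₁) (rest′ ε i i₁)
    (follows-trans p) (follows-exchange p continues)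
    (trans (sym (𝟙-∧ (var (ε , i) ≼ M) _)) (trans (cong 𝟙 (≼-∸ₑ-swap (var (ε , i)) (var (c , i₁)) M)) (𝟙-∧ (var (c , i₁) ≼ M) _)))
    (cong (fillings (just (c , f , i₁)) w) (∸ₑ-swap (var (ε , i)) (var (c , i₁)) M))

productCount≡∑insertionCount : ∀ (p : Maybe (Placed m N)) w M → Linked Continues (fromMaybe (Maybe.map unplace p) ++ w) →
  productCount p w M ≡ ∑[ ε ← allFin m ] insertionCount ε p w M
productCount≡∑insertionCount {m = m} p [] M _ = ∑-cong (allFin m) (λ ε → sym (+-identityʳ _))
productCount≡∑insertionCount {m = m} {N = N} p ((c , f) ∷ w) M linked with linked-uncons p linked
... | continues , linked′ = begin
  productCount p ((c , f) ∷ w) M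
    ≡⟨ productCount-∷ p c f w M continues ⟩
  firsts + ∑[ i₁ ← allFin N ] (p⇝c i₁ * (c∣M i₁ * productCount (just (c , f , i₁)) w (M ∸ₑ var (c , i₁))))
    ≡⟨ cong (firsts +_) (∑-cong (allFin N) (λ i₁ → cong (λ n → p⇝c i₁ * (c∣M i₁ * n))
                          (productCount≡∑insertionCount (just (c , f , i₁)) w (M ∸ₑ var (c , i₁)) linked′))) ⟩
  firsts + ∑[ i₁ ← allFin N ] (p⇝c i₁ * (c∣M i₁ * ∑[ ε ← allFin m ] insertionCount ε (just (c , f , i₁)) w (M ∸ₑ var (c , i₁))))
    ≡⟨ cong (firsts +_) (trans (∑-cong (allFin N) (λ i₁ → sym (∑-*ˡ₂ (allFin m) (p⇝c i₁) (c∣M i₁) _))) (∑-comm (allFin N) (allFin m) _)) ⟩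
  firsts + ∑[ ε ← allFin m ] ∑[ i₁ ← allFin N ] (p⇝c i₁ * (c∣M i₁ * insertionCount ε (just (c , f , i₁)) w (M ∸ₑ var (c , i₁))))
    ≡⟨ cong (firsts +_) (∑-cong (allFin m) (λ ε → sym (fillings-insertAfter-∷ p ε c f w M))) ⟩
  firsts + ∑[ ε ← allFin m ] ∑[ g ← upTo (length ((c , f) ∷ w)) ] fillings p (insertAfter ε (suc g) ((c , f) ∷ w)) M
    ≡⟨ ∑-+ (allFin m) _ _ ⟨
  ∑[ ε ← allFin m ] insertionCount ε p ((c , f) ∷ w) M ∎
  where
  open ≡-Reasoning
  firsts : ℕ
  firsts = ∑[ ε ← allFin m ] fillings (Maybe.map (reflag ε) p) ((ε , true) ∷ (c , f) ∷ w) M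
  p⇝c c∣M : Fin N → ℕ
  p⇝c i₁ = 𝟙 (follows p (c , i₁))
  c∣M i₁ = 𝟙 (var (c , i₁) ≼ M)

≢ᵇ-refl : ∀ (c : Fin m) → c ≢ᵇ c ≡ false
≢ᵇ-refl c = cong not (dec-true (c Fin.≟ c) refl)

≢⇒≢ᵇ : ∀ {c ε : Fin m} → c ≢ ε → c ≢ᵇ ε ≡ true
≢⇒≢ᵇ {c = c} {ε} c≢ε = cong not (dec-false (c Fin.≟ ε) c≢ε)

grow-part : ∀ (c : Fin m) a Y → partLetters (c , suc (suc a)) ++ Y ≡ insertAfter c (suc a) (partLetters (c , suc a) ++ Y)
grow-part c zero Y = cong (λ b → (c , b) ∷ (c , true) ∷ Y) (sym (≢ᵇ-refl c))
grow-part c (suc a) Y = cong ((c , false) ∷_) (grow-part c a Y)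

split-part : ∀ (c : Fin m) h k Y →
  partLetters (c , suc h) ++ partLetters (c , suc k) ++ Y ≡ insertAfter c h (partLetters (c , suc (h + k)) ++ Y)
split-part c zero k Y = refl
split-part c (suc zero) k Y = cong (λ b → (c , b) ∷ (c , true) ∷ partLetters (c , suc k) ++ Y) (sym (≢ᵇ-refl c))
split-part c (suc (suc h)) k Y = cong ((c , false) ∷_) (split-part c (suc h) k Y)

insert-into-part : ∀ {c ε : Fin m} → c ≢ ε → ∀ h k Y →
  partLetters (c , suc h) ++ (ε , true) ∷ partLetters (c , suc k) ++ Y ≡ insertAfter ε (suc h) (partLetters (c , suc (suc h + k)) ++ Y)
insert-into-part {c = c} {ε} c≢ε zero k Y = cong (λ b → (c , b) ∷ (ε , true) ∷ partLetters (c , suc k) ++ Y) (sym (≢⇒≢ᵇ c≢ε))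
insert-into-part {c = c} c≢ε (suc h) k Y = cong ((c , false) ∷_) (insert-into-part c≢ε h k Y)

insert-after-part : ∀ {c ε : Fin m} → c ≢ ε → ∀ a Y →
  partLetters (c , suc a) ++ (ε , true) ∷ Y ≡ insertAfter ε (suc a) (partLetters (c , suc a) ++ Y)
insert-after-part {c = c} {ε} c≢ε zero Y = cong (λ b → (c , b) ∷ (ε , true) ∷ Y) (sym (≢⇒≢ᵇ c≢ε))
insert-after-part {c = c} c≢ε (suc a) Y = cong ((c , false) ∷_) (insert-after-part c≢ε a Y)

insert-same-after-part : ∀ (c : Fin m) a Y → partLetters (c , suc a) ++ (c , true) ∷ Y ≡ insertAfter c a (partLetters (c , suc a) ++ Y)
insert-same-after-part c a Y = subst (λ n → partLetters (c , suc a) ++ (c , true) ∷ Y ≡ insertAfter c a (partLetters (c , suc n) ++ Y))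
  (+-identityʳ a) (split-part c a 0 Y)

suc[m+n]∸m≡suc[n] : ∀ h k → suc (h + k) ∸ h ≡ suc k
suc[m+n]∸m≡suc[n] h k = trans (+-∸-assoc 1 (m≤m+n h k)) (cong suc (m+n∸m≡n h k))

rule2-word : ∀ (c : Fin m) {a h} → h ≤ a → ∀ ps →
  word (deleteZeros ((c , suc h) ∷ (c , suc a ∸ h) ∷ []) ++ ps) ≡ insertAfter c h (partLetters (c , suc a) ++ word ps)
rule2-word c {h = h} h≤a ps with k , refl ← m≤n⇒∃[o]m+o≡n h≤a rewrite suc[m+n]∸m≡suc[n] h k = split-part c h k (word ps)

rule3-word : ∀ {c ε : Fin m} → c ≢ ε → ∀ {a h} → h ≤ suc a → ∀ ps →
  word (deleteZeros ((c , h) ∷ (ε , 1) ∷ (c , suc a ∸ h) ∷ []) ++ ps) ≡ insertAfter ε h (partLetters (c , suc a) ++ word ps)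
rule3-word c≢ε {h = zero} _ ps = refl
rule3-word c≢ε {a} {suc h} (s≤s h≤a) ps with m≤n⇒m<n∨m≡n h≤a
... | inj₂ refl rewrite n∸n≡0 h = insert-after-part c≢ε h (word ps)
... | inj₁ h<a with k , refl ← m≤n⇒∃[o]m+o≡n h<a rewrite suc[m+n]∸m≡suc[n] h k = insert-into-part c≢ε h k (word ps)

∈-if-no : ∀ {P : Set} (d : Dec P) (x : A) → ¬ P → x ∈ (if ⌊ d ⌋ then [] else x ∷ [])
∈-if-no (yes p) x ¬p = ⊥-elim (¬p p)
∈-if-no (no _) x ¬p = here refl

module _ (c : Fin m) (a : ℕ) where

  private
    rule2 : ℕ → ColComp m
    rule2 h = (c , suc h) ∷ (c , suc a ∸ h) ∷ []

    rule3 : ℕ → Fin m → ColComp m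
    rule3 h ε = (c , h) ∷ (ε , 1) ∷ (c , suc a ∸ h) ∷ []

    rule3-if : ℕ → Fin m → List (ColComp m)
    rule3-if h ε = if ⌊ ε Fin.≟ c ⌋ then [] else (rule3 h ε ∷ [])

  InsertsAt : Fin m → ℕ → ColComp m → Set
  InsertsAt ε g loc = ∀ ps → word (deleteZeros loc ++ ps) ≡ insertAfter ε g (partLetters (c , suc a) ++ word ps)

  localCover⇒insertion : ∀ {loc} → loc ∈ localCovers (c , suc a) → Σ[ ε ∈ Fin m ] Σ[ g ∈ ℕ ] g ≤ suc a × InsertsAt ε g loc
  localCover⇒insertion (here refl) = c , suc a , ≤-refl , λ ps → grow-part c a (word ps)
  localCover⇒insertion (there loc∈) with ∈-++⁻ (map rule2 (upTo (suc a))) loc∈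
  ... | inj₁ loc∈₂ with h , h∈ , refl ← ∈-map⁻ rule2 loc∈₂ = c , h , <⇒≤ (∈-upTo⁻ h∈) , rule2-word c (≤-pred (∈-upTo⁻ h∈))
  ... | inj₂ loc∈₃ with h , h∈ , loc∈ₕ ← find (∈-concatMap⁻ (λ h → concatMap (rule3-if h) (allFin m)) loc∈₃) =
    let ε , _ , loc∈ₕ,ε = find (∈-concatMap⁻ (rule3-if h) {xs = allFin m} loc∈ₕ) in rule3-member {ε = ε} (≤-pred (∈-upTo⁻ h∈)) loc∈ₕ,ε
    where
    rule3-member : ∀ {h ε loc} → h ≤ suc a → loc ∈ rule3-if h ε → Σ[ ε ∈ Fin m ] Σ[ g ∈ ℕ ] g ≤ suc a × InsertsAt ε g loc
    rule3-member {h} {ε} h≤ loc∈ with ε Fin.≟ c | loc∈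
    ... | no ε≢c | here refl = ε , h , h≤ , rule3-word (ε≢c ∘ sym) h≤

  insertion⇒localCover : ∀ ε g → g ≤ suc a → Σ[ loc ∈ ColComp m ] loc ∈ localCovers (c , suc a) × InsertsAt ε g loc
  insertion⇒localCover ε g g≤ with ε Fin.≟ c
  ... | yes refl with m≤n⇒m<n∨m≡n g≤
  ...   | inj₂ refl = _ , here refl , λ ps → grow-part c a (word ps)
  ...   | inj₁ g< = rule2 g , there (∈-++⁺ˡ (∈-map⁺ rule2 (∈-upTo⁺ g<))) , rule2-word c (≤-pred g<)
  insertion⇒localCover ε g g≤ | no ε≢c =
    rule3 g ε ,
    there (∈-++⁺ʳ (map rule2 (upTo (suc a)))
      (∈-concatMap⁺ (λ h → concatMap (rule3-if h) (allFin m))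
        (lose (∈-upTo⁺ (s≤s g≤)) (∈-concatMap⁺ (rule3-if g) (lose (∈-allFin ε) (∈-if-no (ε Fin.≟ c) (rule3 g ε) ε≢c)))))) ,
    rule3-word (ε≢c ∘ sym) g≤

insertAfter-++ : ∀ (ε : Fin m) u v g → insertAfter ε (suc (length u + g)) (u ++ v) ≡ u ++ insertAfter ε (suc g) v
insertAfter-++ ε [] v g = refl
insertAfter-++ ε (x ∷ u) v g = cong (x ∷_) (insertAfter-++ ε u v g)

length-partLetters : ∀ (c : Fin m) a → length (partLetters (c , suc a)) ≡ suc a
length-partLetters c zero = refl
length-partLetters c (suc a) = cong suc (length-partLetters c a)

length-word-∷ : ∀ (c : Fin m) a ps → length (word ((c , suc a) ∷ ps)) ≡ suc a + length (word ps)
length-word-∷ c a ps = trans (length-++ (partLetters (c , suc a))) (cong (_+ length (word ps)) (length-partLetters c a))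

deleteZeros-++ : ∀ (loc ps : ColComp m) → IsColComp ps → deleteZeros (loc ++ ps) ≡ deleteZeros loc ++ ps
deleteZeros-++ loc ps ps⁺ = trans (filter-++ nonzero? loc ps) (cong (deleteZeros loc ++_) (filter-all nonzero? (All.map >⇒≢ ps⁺)))
  where
  nonzero? : (p : Fin m × ℕ) → Dec (proj₂ p ≢ 0)
  nonzero? p = ¬? (proj₂ p ≟ 0)

coversAt⇒insertion : ∀ (α : ColComp m) → IsColComp α → ∀ {γ} → γ ∈ coversAt α →
  Σ[ ε ∈ Fin m ] Σ[ g ∈ ℕ ] g ≤ length (word α) × word (deleteZeros γ) ≡ insertAfter ε g (word α)
coversAt⇒insertion {m = m} ((c , suc a) ∷ ps) (_ ∷ ps⁺) γ∈ with ∈-++⁻ (map (_++ ps) (localCovers (c , suc a))) γ∈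
... | inj₁ γ∈₁ with loc , loc∈ , refl ← ∈-map⁻ (_++ ps) γ∈₁ =
  let ε , g , g≤ , inserts = localCover⇒insertion c a loc∈ in
  ε , g , ≤-trans g≤ (subst (suc a ≤_) (sym (length-word-∷ c a ps)) (m≤m+n (suc a) _)) ,
  trans (cong word (deleteZeros-++ loc ps ps⁺)) (inserts ps)
... | inj₂ γ∈₂ with γ′ , γ′∈ , refl ← ∈-map⁻ ((c , suc a) ∷_) γ∈₂ with coversAt⇒insertion ps ps⁺ γ′∈
...   | ε , suc g , g< , eq = ε , suc (length u + g) ,
          subst (suc (length u + g) ≤_) (sym (length-++ u)) (subst (_≤ length u + length (word ps)) (+-suc (length u) g) (+-monoʳ-≤ (length u) g<)) ,
          trans (cong (u ++_) eq) (sym (insertAfter-++ ε u (word ps) g))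
  where
  u : List (Letter m)
  u = partLetters (c , suc a)
...   | ε , zero , _ , eq with ε Fin.≟ c
...     | yes refl = ε , a , ≤-trans (n≤1+n a) (subst (suc a ≤_) (sym (length-word-∷ c a ps)) (m≤m+n (suc a) _)) ,
                     trans (cong (partLetters (c , suc a) ++_) eq) (insert-same-after-part c a (word ps))
...     | no ε≢c = ε , suc a , subst (suc a ≤_) (sym (length-word-∷ c a ps)) (m≤m+n (suc a) _) ,
                   trans (cong (partLetters (c , suc a) ++_) eq) (insert-after-part (ε≢c ∘ sym) a (word ps))

insertion⇒coversAt : ∀ (c : Fin m) a ps → IsColComp ps → ∀ ε g → g ≤ length (word ((c , suc a) ∷ ps)) →
  Σ[ γ ∈ ColComp m ] γ ∈ coversAt ((c , suc a) ∷ ps) × word (deleteZeros γ) ≡ insertAfter ε g (word ((c , suc a) ∷ ps))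
insertion⇒coversAt {m = m} c a ps ps⁺ ε g g≤ with g ≤? suc a
... | yes g≤suc-a =
  let loc , loc∈ , inserts = insertion⇒localCover c a ε g g≤suc-a in
  loc ++ ps , ∈-++⁺ˡ (∈-map⁺ (_++ ps) loc∈) , trans (cong word (deleteZeros-++ loc ps ps⁺)) (inserts ps)
... | no g≰suc-a with o , refl ← m≤n⇒∃[o]m+o≡n (≰⇒> g≰suc-a) =
  inTail ps ps⁺ (+-cancelˡ-≤ a (suc o) _ (subst (_≤ a + length (word ps)) (sym (+-suc a o)) (≤-pred (subst (suc (suc a + o) ≤_) (length-word-∷ c a ps) g≤))))
  where
  u : List (Letter m)
  u = partLetters (c , suc a)
  inTail : ∀ ps → IsColComp ps → suc o ≤ length (word ps) →
    Σ[ γ ∈ ColComp m ] γ ∈ coversAt ((c , suc a) ∷ ps) × word (deleteZeros γ) ≡ insertAfter ε (suc (suc a + o)) (u ++ word ps)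
  inTail ((c′ , suc a′) ∷ ps′) (_ ∷ ps′⁺) o< =
    let γ′ , γ′∈ , eq = insertion⇒coversAt c′ a′ ps′ ps′⁺ ε (suc o) o< in
    (c , suc a) ∷ γ′ , ∈-++⁺ʳ (map (_++ (c′ , suc a′) ∷ ps′) (localCovers (c , suc a))) (∈-map⁺ ((c , suc a) ∷_) γ′∈) ,
    trans (cong (u ++_) eq) (trans (sym (insertAfter-++ ε u _ o)) (cong (λ n → insertAfter ε (suc (n + o)) (u ++ _)) (length-partLetters c a)))

coverList⇒insertion : ∀ (α : ColComp m) → IsColComp α → ∀ {β} → β ∈ coverList α →
  Σ[ ε ∈ Fin m ] Σ[ g ∈ ℕ ] g ≤ length (word α) × word β ≡ insertAfter ε g (word α)
coverList⇒insertion [] _ β∈ with ε , _ , refl ← ∈-map⁻ (λ ε → (ε , 1) ∷ []) β∈ = ε , 0 , z≤n , refl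
coverList⇒insertion (p ∷ ps) α⁺ β∈ with γ , γ∈ , refl ← ∈-map⁻ deleteZeros β∈ = coversAt⇒insertion (p ∷ ps) α⁺ γ∈

insertion⇒coverList : ∀ (α : ColComp m) → IsColComp α → ∀ ε g → g ≤ length (word α) →
  Σ[ β ∈ ColComp m ] β ∈ coverList α × word β ≡ insertAfter ε g (word α)
insertion⇒coverList [] _ ε zero _ = (ε , 1) ∷ [] , ∈-map⁺ (λ ε → (ε , 1) ∷ []) (∈-allFin ε) , refl
insertion⇒coverList ((c , suc a) ∷ ps) (_ ∷ ps⁺) ε g g≤ =
  let γ , γ∈ , eq = insertion⇒coversAt c a ps ps⁺ ε g g≤ in deleteZeros γ , ∈-map⁺ deleteZeros γ∈ , eq

coverList-IsColComp : ∀ (α : ColComp m) {β} → β ∈ coverList α → IsColComp β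
coverList-IsColComp [] β∈ with ε , _ , refl ← ∈-map⁻ (λ ε → (ε , 1) ∷ []) β∈ = s≤s z≤n ∷ []
coverList-IsColComp (p ∷ ps) β∈ with γ , _ , refl ← ∈-map⁻ deleteZeros {xs = coversAt (p ∷ ps)} β∈ =
  All.map n≢0⇒n>0 (all-filter (λ q → ¬? (proj₂ q ≟ 0)) γ)

growFirst : Fin m → ColComp m → ColComp m
growFirst c [] = (c , 1) ∷ []
growFirst c ((_ , k) ∷ α) = (c , suc k) ∷ α

unword : List (Letter m) → ColComp m
unword [] = []
unword ((c , true) ∷ w) = (c , 1) ∷ unword w
unword ((c , false) ∷ w) = growFirst c (unword w)

unword-partLetters : ∀ (c : Fin m) a w → unword (partLetters (c , suc a) ++ w) ≡ (c , suc a) ∷ unword w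
unword-partLetters c zero w = refl
unword-partLetters c (suc a) w = cong (growFirst c) (unword-partLetters c a w)

unword-word : ∀ {α : ColComp m} → IsColComp α → unword (word α) ≡ α
unword-word [] = refl
unword-word {α = (c , suc a) ∷ α} (_ ∷ α⁺) = trans (unword-partLetters c a (word α)) (cong ((c , suc a) ∷_) (unword-word α⁺))

word-injective : ∀ {α β : ColComp m} → IsColComp α → IsColComp β → word α ≡ word β → α ≡ β
word-injective α⁺ β⁺ eq = trans (sym (unword-word α⁺)) (trans (cong unword eq) (unword-word β⁺))

insertAfter-head : ∀ (ε ε′ : Fin m) g w → suc g ≤ length w → (ε , true) ∷ w ≢ insertAfter ε′ (suc g) w
insertAfter-head ε ε′ zero ((c , f) ∷ w) _ eq with ∷-injective eq
... | head≡ , tail≡ with ∷-injectiveˡ tail≡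
...   | refl = true≢false (trans (cong proj₂ head≡) (≢ᵇ-refl ε′))
  where
  true≢false : true ≢ false
  true≢false ()
insertAfter-head ε ε′ (suc g) ((c , f) ∷ w) (s≤s g<) eq with ∷-injective eq
... | refl , tail≡ = insertAfter-head ε ε′ g w g< tail≡

insertAfter-injective : ∀ (ε ε′ : Fin m) g g′ w → g ≤ length w → g′ ≤ length w →
  insertAfter ε g w ≡ insertAfter ε′ g′ w → ε ≡ ε′ × g ≡ g′
insertAfter-injective ε ε′ zero zero w _ _ eq = cong proj₁ (∷-injectiveˡ eq) , refl
insertAfter-injective ε ε′ zero (suc g′) w _ g′≤ eq = ⊥-elim (insertAfter-head ε ε′ g′ w g′≤ eq)
insertAfter-injective ε ε′ (suc g) zero w g≤ _ eq = ⊥-elim (insertAfter-head ε′ ε g w g≤ (sym eq))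
insertAfter-injective ε ε′ (suc zero) (suc zero) (x ∷ w) _ _ eq = cong proj₁ (∷-injectiveˡ (∷-injectiveʳ eq)) , refl
insertAfter-injective ε ε′ (suc zero) (suc (suc g′)) (x ∷ w) _ (s≤s g′≤) eq = ⊥-elim (insertAfter-head ε ε′ g′ w g′≤ (∷-injectiveʳ eq))
insertAfter-injective ε ε′ (suc (suc g)) (suc zero) (x ∷ w) (s≤s g≤) _ eq = ⊥-elim (insertAfter-head ε′ ε g w g≤ (sym (∷-injectiveʳ eq)))
insertAfter-injective ε ε′ (suc (suc g)) (suc (suc g′)) (x ∷ w) (s≤s g≤) (s≤s g′≤) eq =
  let ε≡ε′ , g≡g′ = insertAfter-injective ε ε′ (suc g) (suc g′) w g≤ g′≤ (∷-injectiveʳ eq) in ε≡ε′ , cong suc g≡g′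

linked-after-end : ∀ {c : Fin m} w → Linked Continues w → Linked Continues ((c , true) ∷ w)
linked-after-end [] _ = [-]
linked-after-end (_ ∷ _) linked = (λ ()) ∷ linked

linked-partLetters : ∀ (c : Fin m) a {w} → Linked Continues w → Linked Continues (partLetters (c , suc a) ++ w)
linked-partLetters c zero linked = linked-after-end _ linked
linked-partLetters c (suc zero) linked = (λ _ → refl) ∷ linked-after-end _ linked
linked-partLetters c (suc (suc a)) linked = (λ _ → refl) ∷ linked-partLetters c (suc a) linked

word-linked : ∀ {α : ColComp m} → IsColComp α → Linked Continues (word α)
word-linked [] = []
word-linked {α = (c , suc a) ∷ α} (_ ∷ α⁺) = linked-partLetters c a (word-linked α⁺)

L-single : ∀ (ε : Fin m) N M → L ((ε , 1) ∷ []) N M ≡ ∑[ i ← allFin N ] 𝟙 (does (var (ε , i) ≟ₑ M))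
L-single ε N M = trans (L-fillings ((ε , 1) ∷ []) N M) (∑-cong (allFin N) single)
  where
  single : ∀ i → 1 * (𝟙 (var (ε , i) ≼ M) * 𝟙 (does (zeroMono ≟ₑ (M ∸ₑ var (ε , i))))) ≡ 𝟙 (does (var (ε , i) ≟ₑ M))
  single i = begin
    1 * (𝟙 (var (ε , i) ≼ M) * 𝟙 (does (zeroMono ≟ₑ (M ∸ₑ var (ε , i)))))  ≡⟨ trans (*-identityˡ _) (sym (𝟙-∧ (var (ε , i) ≼ M) _)) ⟩
    𝟙 (var (ε , i) ≼ M ∧ does (zeroMono ≟ₑ (M ∸ₑ var (ε , i))))           ≡⟨ cong 𝟙 (+ₑ-≡-split (var (ε , i)) zeroMono M) ⟨
    𝟙 (does ((var (ε , i) +ₑ zeroMono) ≟ₑ M))                               ≡⟨ cong (λ X → 𝟙 (does (X ≟ₑ M))) (monoOf-∷ (ε , i) []) ⟨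
    𝟙 (does (var (ε , i) ≟ₑ M)) ∎
    where open ≡-Reasoning

⊗≡productCount : ∀ (α : ColComp m) N M → (sumL1 m ⊗ L α) N M ≡ productCount nothing (word α) M
⊗≡productCount {m = m} α N M = begin
  ∑[ M₁ ← belowMono M ] (sumL1 m N M₁ * rest M₁)
    ≡⟨ ∑-cong (belowMono M) (λ M₁ → cong (_* rest M₁) (trans (sumS-map (λ ε → L ((ε , 1) ∷ [])) (allFin m) N M₁)
                                                             (∑-cong (allFin m) (λ ε → L-single ε N M₁)))) ⟩
  ∑[ M₁ ← belowMono M ] ((∑[ ε ← allFin m ] ∑[ i ← allFin N ] 𝟙 (does (var (ε , i) ≟ₑ M₁))) * rest M₁)
    ≡⟨ ∑-cong (belowMono M) (λ M₁ → trans (∑-*ʳ (allFin m) _ (rest M₁)) (∑-cong (allFin m) (λ ε → ∑-*ʳ (allFin N) _ (rest M₁)))) ⟩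
  ∑[ M₁ ← belowMono M ] ∑[ ε ← allFin m ] ∑[ i ← allFin N ] (𝟙 (does (var (ε , i) ≟ₑ M₁)) * rest M₁)
    ≡⟨ trans (∑-comm (belowMono M) (allFin m) _) (∑-cong (allFin m) (λ ε → ∑-comm (belowMono M) (allFin N) _)) ⟩
  ∑[ ε ← allFin m ] ∑[ i ← allFin N ] ∑[ M₁ ← belowMono M ] (𝟙 (does (var (ε , i) ≟ₑ M₁)) * rest M₁)
    ≡⟨ ∑-cong (allFin m) (λ ε → ∑-cong (allFin N) (λ i → trans (∑-below-pick M (var (ε , i)) rest)
                                                        (trans (cong (𝟙 (var (ε , i) ≼ M) *_) (L-fillings α N (M ∸ₑ var (ε , i)))) (sym (*-identityˡ _))))) ⟩
  productCount nothing (word α) M ∎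
  where
  open ≡-Reasoning
  rest : Mono m N → ℕ
  rest M₁ = L α N (M ∸ₑ M₁)

positions : ColComp m → List (Fin m × ℕ)
positions {m} α = cartesianProduct (allFin m) (upTo (suc (length (word α))))

insertAt : ColComp m → Fin m × ℕ → List (Letter m)
insertAt α (ε , g) = insertAfter ε g (word α)

position≤ : ∀ {α : ColComp m} {εg} → εg ∈ positions α → proj₂ εg ≤ length (word α)
position≤ {m} {α} εg∈ = ≤-pred (∈-upTo⁻ (proj₂ (∈-cartesianProduct⁻ (allFin m) (upTo (suc (length (word α)))) εg∈)))

insertions-unique : ∀ (α : ColComp m) → Unique (map (insertAt α) (positions α))
insertions-unique {m} α = Unique-map⁺-on (insertAt α) (cartesianProduct⁺ (allFin⁺ m) (upTo⁺ _)) (All.tabulate (position≤ {α = α}))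
  (λ {(ε , g)} {(ε′ , g′)} g≤ g′≤ eq →
     let ε≡ε′ , g≡g′ = insertAfter-injective ε ε′ g g′ (word α) g≤ g′≤ eq in cong₂ _,_ ε≡ε′ g≡g′)

coverWords-unique : ∀ (α : ColComp m) → Unique (map word (coverSet α))
coverWords-unique α = Unique-map⁺-on word (deduplicate-! _≟C_ (coverList α))
  (All.tabulate (coverList-IsColComp α ∘ ∈-deduplicate⁻ _≟C_ (coverList α))) word-injective

insertion⇒coverWord : ∀ {α : ColComp m} → IsColComp α → ∀ {w} → w ∈ map (insertAt α) (positions α) → w ∈ map word (coverSet α)
insertion⇒coverWord {α = α} α⁺ w∈ with (ε , g) , εg∈ , refl ← ∈-map⁻ (insertAt α) w∈ =
  let β , β∈ , eq = insertion⇒coverList α α⁺ ε g (position≤ {α = α} εg∈) in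
  subst (_∈ map word (coverSet α)) eq (∈-map⁺ word (∈-deduplicate⁺ _≟C_ β∈))

coverWord⇒insertion : ∀ {α : ColComp m} → IsColComp α → ∀ {w} → w ∈ map word (coverSet α) → w ∈ map (insertAt α) (positions α)
coverWord⇒insertion {α = α} α⁺ w∈ with β , β∈ , refl ← ∈-map⁻ word w∈ =
  let ε , g , g≤ , eq = coverList⇒insertion α α⁺ (∈-deduplicate⁻ _≟C_ (coverList α) β∈) in
  subst (_∈ map (insertAt α) (positions α)) (sym eq) (∈-map⁺ (insertAt α) (∈-cartesianProduct⁺ (∈-allFin ε) (∈-upTo⁺ (s≤s g≤))))

∑insertionCount≡∑L : ∀ (α : ColComp m) → IsColComp α → ∀ N M →
  ∑[ ε ← allFin m ] insertionCount ε nothing (word α) M ≡ sumS (map L (coverSet α)) N M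
∑insertionCount≡∑L {m = m} α α⁺ N M = begin
  ∑[ ε ← allFin m ] insertionCount ε nothing (word α) M
    ≡⟨ ∑-cong (allFin m) (λ ε → sym (∑-upTo-suc (length (word α)) (λ g → count (insertAfter ε g (word α))))) ⟩
  ∑[ ε ← allFin m ] ∑[ g ← upTo (suc (length (word α))) ] count (insertAfter ε g (word α))
    ≡⟨ sym (∑-cartesianProduct (allFin m) (upTo (suc (length (word α)))) (count ∘ insertAt α)) ⟩
  ∑ (positions α) (count ∘ insertAt α)
    ≡⟨ sym (∑-map (insertAt α) (positions α) count) ⟩
  ∑ (map (insertAt α) (positions α)) count
    ≡⟨ ∑-unique-sameElements count (insertions-unique α) (coverWords-unique α) (insertion⇒coverWord α⁺) (coverWord⇒insertion α⁺) ⟩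
  ∑ (map word (coverSet α)) count
    ≡⟨ ∑-map word (coverSet α) count ⟩
  ∑[ β ← coverSet α ] count (word β)
    ≡⟨ ∑-cong (coverSet α) (λ β → sym (L-fillings β N M)) ⟩
  ∑[ β ← coverSet α ] L β N M
    ≡⟨ sym (sumS-map L (coverSet α) N M) ⟩
  sumS (map L (coverSet α)) N M ∎
  where
  open ≡-Reasoning
  count : List (Letter m) → ℕ
  count w = fillings nothing w M

proposition3p1 : (m : ℕ) → 1 ≤ m → (α : ColComp m) → IsColComp α →
    (sumL1 m ⊗ L α) ≈ sumS (map L (coverSet α))
proposition3p1 m _ α α⁺ N M = begin
  (sumL1 m ⊗ L α) N M                                   ≡⟨ ⊗≡productCount α N M ⟩
  productCount nothing (word α) M                       ≡⟨ productCount≡∑insertionCount nothing (word α) M (word-linked α⁺) ⟩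
  ∑[ ε ← allFin m ] insertionCount ε nothing (word α) M ≡⟨ ∑insertionCount≡∑L α α⁺ N M ⟩
  sumS (map L (coverSet α)) N M                         ∎
  where open ≡-Reasoning
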